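{- The tree record numbers satisfy, for $n\ge1$ and $2\le k\le n$, \[ R_\bullet(n,k)=\sum_{i=k-1}^{n-1}\binom{n-1}{i}R_\bullet(i,k-1)\,(n-i)^{n-i-2}\, i, \] with $R_\bullet(n,1)=n^{n-2}$ for $n\ge1$, and $R_\bullet(n,k)=0$ otherwise. The forest record numbers satisfy, for $n\ge1$ and $1\le k\le n$, \[ R(n,k)=\sum_{i=k-1}^{n-1}\binom{n-1}{i}R(i,k-1)\,(n-i)^{n-i-2}\,(i+1), \] with $R(0,0)=1$ and $R(n,k)=0$ otherwise.
   Context: A vertex of a rooted labelled tree is a record if its label is the largest on the path from it to the root (inclusive); in a rooted forest (set of rooted trees with disjoint vertex sets whose union is $[n]=\{1,\dots,n\}$) a vertex is a record if it is a record of its tree. $R_\bullet(n,k)$ is the number of rooted trees on $[n]$ with exactly $k$ records and $R(n,k)$ the number of rooted forests on $[n]$ with exactly $k$ records. The value $1^{ -1}$ is read as $1$. -}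

module Defs where

open import Data.Nat using (ℕ; zero; suc; _+_; _*_; _∸_; _^_; _≤ᵇ_)
open import Data.Bool using (Bool; true; false; _∧_; if_then_else_)
open import Data.Maybe using (Maybe; nothing; just)
open import Data.Fin using (Fin; zero; suc; toℕ)
open import Data.List using (List; []; _∷_; map; concatMap; filter; length; allFin; upTo; foldr)
open import Data.Nat.ListAction using (sum)
open import Data.Bool using (T)
open import Relation.Nullary.Decidable using (T?)

-- A rooted forest on [n] (vertices = Fin n, vertex i has label
-- toℕ i + 1, so the label order is the order of toℕ) is encoded by its
-- parent map  p : Fin n → Maybe (Fin n)  (p v = nothing iff v is a root),
-- subject to acyclicity: following parents from any vertex reaches a root.

ParentMap : ℕ → Set
ParentMap n = Fin n → Maybe (Fin n)

extend : ∀ {m n} → Maybe (Fin n) → (Fin m → Maybe (Fin n)) → Fin (suc m) → Maybe (Fin n)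
extend x f zero    = x
extend x f (suc i) = f i

options : (n : ℕ) → List (Maybe (Fin n))
options n = nothing ∷ map just (allFin n)

allMaps : (m n : ℕ) → List (Fin m → Maybe (Fin n))
allMaps zero    n = (λ ()) ∷ []
allMaps (suc m) n = concatMap (λ f → map (λ x → extend x f) (options n)) (allMaps m n)

reachesRoot : ∀ {n} → ℕ → ParentMap n → Fin n → Bool
reachesRoot zero    p u = false
reachesRoot (suc k) p u with p u
... | nothing = true
... | just w  = reachesRoot k p w

allB : ∀ {A : Set} → (A → Bool) → List A → Bool
allB P = foldr (λ x b → P x ∧ b) true

countB : ∀ {A : Set} → (A → Bool) → List A → ℕ
countB P xs = length (filter (λ x → T? (P x)) xs)

-- p is a rooted forest: every vertex reaches a root (a path in an
-- acyclic structure on n vertices needs at most n steps)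
isForest : ∀ {n} → ParentMap n → Bool
isForest {n} p = allB (reachesRoot n p) (allFin n)

isRootB : ∀ {n} → ParentMap n → Fin n → Bool
isRootB p v with p v
... | nothing = true
... | just _  = false

isTree : ∀ {n} → ParentMap n → Bool
isTree {n} p = isForest p ∧ (countB (isRootB p) (allFin n) ≡ᵇ 1)
  where open import Data.Nat using (_≡ᵇ_)

path : ∀ {n} → ℕ → ParentMap n → Fin n → List (Fin n)
path zero    p u = []
path (suc k) p u with p u
... | nothing = u ∷ []
... | just w  = u ∷ path k p w

-- v is a record: its label is the largest on the path from v to its root
-- (in a forest this path has at most n vertices)
isRecord : ∀ {n} → ParentMap n → Fin n → Bool
isRecord {n} p v = allB (λ u → toℕ u ≤ᵇ toℕ v) (path n p v)

records : ∀ {n} → ParentMap n → ℕ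
records {n} p = countB (isRecord p) (allFin n)

hasRecords : ∀ {n} → ℕ → ParentMap n → Bool
hasRecords k p = records p ≡ᵇ k
  where open import Data.Nat using (_≡ᵇ_)

Rtree : ℕ → ℕ → ℕ
Rtree n k = countB (λ p → isTree p ∧ hasRecords k p) (allMaps n n)

Rforest : ℕ → ℕ → ℕ
Rforest n k = countB (λ p → isForest p ∧ hasRecords k p) (allMaps n n)

sumFromTo : ℕ → ℕ → (ℕ → ℕ) → ℕ
sumFromTo a b f = sum (map (λ j → f (a + j)) (upTo (suc b ∸ a)))

{-# OPTIONS --safe #-}

-- Let n be the largest label of a forest on [n]. The proper descendants of n form a forest on a set B
-- whose roots are the children of n; the other vertices form a forest on A = [n - 1] ∖ B, in which n is
-- either a root or the child of a vertex of A. This is a bijection between forests on [n] and such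
-- triples, for every A. The vertex n is a record, no vertex of B is one (its path passes through n), and
-- the records in A are unchanged because relabelling A by 1, …, |A| preserves the order of labels; so the
-- forest has one record more than the forest on A. It is a tree exactly when the forest on A is a tree
-- and n hangs below it. Grouping by i = |A| gives the binomial coefficient and the factor i + 1 (forests)
-- or i (trees), and the forests on B are counted by Cayley's formula (n - i)^(n - i - 2). Cayley's
-- formula comes from the same decomposition at the roots: forests on N vertices whose roots carry one of
-- k colours number k (k + N)^(N - 1), since by Abel's identity this satisfies the resulting recurrence.

module Submission where

open import Defs
open import Data.Bool using (Bool; true; false; T; _∧_; _∨_; not)
open import Data.Bool.ListAction using (any)
open import Data.Bool.Properties
  using (T-irrelevant; T-∧; T-≡; ⇔→≡; ∧-assoc; ∧-zeroʳ; ∧-identityʳ; ∨-zeroʳ; not-injective)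
open import Data.Empty using (⊥; ⊥-elim)
open import Data.Fin using (Fin; zero; suc; toℕ; fromℕ; inject₁)
open import Data.Fin.Permutation using (↔⇒≡)
open import Data.Fin.Properties
  using (+↔⊎; *↔×; 0↔⊥; 1↔⊤; pigeonhole; toℕ<n; toℕ-injective; toℕ-fromℕ; toℕ-inject₁)
open import Data.List using (List; []; _∷_; map; concatMap; allFin; _++_; applyUpTo)
import Data.List as List
open import Data.List.Properties using (map-++; map-∘; map-cong; map-tabulate)
open import Data.Maybe using (Maybe; nothing; just; _>>=_; is-just; is-nothing; fromMaybe)
import Data.Maybe as Maybe
open import Data.Nat using (ℕ; zero; suc; _+_; _*_; _∸_; _^_; _≤_; _<_; z≤n; s≤s; _≡ᵇ_; _≤ᵇ_; _≤?_)
open import Data.Nat.Combinatorics using (_C_; nCk+nC[k+1]≡[n+1]C[k+1]; k>n⇒nCk≡0; nCn≡1; nC1≡n)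
open import Data.Nat.Induction using (<-rec)
open import Data.Nat.ListAction using (sum)
open import Data.Nat.ListAction.Properties using (sum-++)
open import Data.Nat.Properties
  using ( +-comm; +-assoc; +-suc; +-identityʳ; +-mono-≤; +-monoˡ-<; +-∸-assoc; +-commutativeSemigroup
        ; *-comm; *-assoc; *-zeroʳ; *-distribˡ-+; *-distribʳ-+
        ; ≤-refl; ≤-trans; ≤-pred; ≤-antisym; <⇒≤; <⇒≱; <⇒≢; ≰⇒>; <-cmp
        ; n≤1+n; n<1+n; m≤m+n; m≤n+m; m≤n⇒m≤1+n; m+[n∸m]≡n; m+n∸m≡n; n∸n≡0
        ; ≡ᵇ⇒≡; ≡⇒≡ᵇ; ≤ᵇ⇒≤; ≤⇒≤ᵇ )
open import Algebra.Properties.CommutativeSemigroup +-commutativeSemigroup using (interchange; x∙yz≈y∙xz)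
open import Data.Nat.Solver using (module +-*-Solver)
open import Data.Product using (Σ; _×_; _,_; proj₁; proj₂; ∃)
open import Data.Product.Function.NonDependent.Propositional using (_×-↔_)
open import Data.Sum using (_⊎_; inj₁; inj₂; [_,_])
import Data.Sum as Sum
open import Data.Sum.Function.Propositional using (_⊎-↔_)
open import Data.Vec using (Vec; []; _∷_; lookup; tabulate; head; tail)
import Data.Vec as V
open import Data.Vec.Properties using (lookup-map; lookup∘tabulate; tabulate∘lookup; tabulate-cong)
import Data.Vec.Properties as Vecₚ
open import Function using (_∘_; id; const; case_of_)
open import Function.Bundles using (_↔_; mk↔ₛ′; mk⇔; Inverse; Equivalence)
open import Function.Properties.Inverse using (↔-refl; ↔-sym; ↔-trans)
open import Function.Related.TypeIsomorphisms using (Σ-assoc)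
open import Relation.Binary.Definitions using (tri<; tri≈; tri>)
open import Relation.Binary.PropositionalEquality
  using (_≡_; _≢_; refl; sym; trans; cong; cong₂; subst; subst₂; _≗_; module ≡-Reasoning)
open import Relation.Nullary using (¬_; yes; no)

open Inverse using (to; from; strictlyInverseˡ; strictlyInverseʳ)
open +-*-Solver using (solve; _:+_; _:*_; _:=_; con)

private variable
  A B : Set
  a b m n : ℕ


⟦_⟧ : Bool → ℕ
⟦ true ⟧  = 1
⟦ false ⟧ = 0

∑Fin : (n : ℕ) → (Fin n → ℕ) → ℕ
∑Fin zero    c = 0
∑Fin (suc n) c = c zero + ∑Fin n (c ∘ suc)

∑Fin-cong : ∀ n {c d : Fin n → ℕ} → c ≗ d → ∑Fin n c ≡ ∑Fin n d
∑Fin-cong zero    e = refl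
∑Fin-cong (suc n) e = cong₂ _+_ (e zero) (∑Fin-cong n (e ∘ suc))

∑Fin-zero : ∀ n → ∑Fin n (λ _ → 0) ≡ 0
∑Fin-zero zero    = refl
∑Fin-zero (suc n) = ∑Fin-zero n

∑Fin-last : ∀ m (c : Fin (suc m) → ℕ) → ∑Fin (suc m) c ≡ ∑Fin m (c ∘ inject₁) + c (fromℕ m)
∑Fin-last zero    c = +-comm (c zero) 0
∑Fin-last (suc m) c = trans (cong (c zero +_) (∑Fin-last m (c ∘ suc))) (sym (+-assoc (c zero) _ _))

⟦⟧-mono : ∀ {a b} → (a ≡ true → b ≡ true) → ⟦ a ⟧ ≤ ⟦ b ⟧
⟦⟧-mono {false} _   = z≤n
⟦⟧-mono {true}  a⇒b rewrite a⇒b refl = s≤s z≤n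

∑Fin-mono : ∀ n {c d : Fin n → ℕ} → (∀ i → c i ≤ d i) → ∑Fin n c ≤ ∑Fin n d
∑Fin-mono zero    c≤d = z≤n
∑Fin-mono (suc n) c≤d = +-mono-≤ (c≤d zero) (∑Fin-mono n (c≤d ∘ suc))

∑Fin-≥ : ∀ n (c : Fin n → ℕ) i → c i ≤ ∑Fin n c
∑Fin-≥ (suc n) c zero    = m≤m+n (c zero) _
∑Fin-≥ (suc n) c (suc i) = ≤-trans (∑Fin-≥ n (c ∘ suc) i) (m≤n+m _ (c zero))

∑Fin-≤ : ∀ n (c : Fin n → ℕ) → (∀ i → c i ≤ 1) → ∑Fin n c ≤ n
∑Fin-≤ zero    c c≤1 = z≤n
∑Fin-≤ (suc n) c c≤1 = +-mono-≤ (c≤1 zero) (∑Fin-≤ n (c ∘ suc) (c≤1 ∘ suc))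

∑Bools : (m : ℕ) → (Vec Bool m → ℕ) → ℕ
∑Bools zero    c = c []
∑Bools (suc m) c = ∑Bools m (c ∘ (true ∷_)) + ∑Bools m (c ∘ (false ∷_))

∑Bools-cong : ∀ m {c d : Vec Bool m → ℕ} → c ≗ d → ∑Bools m c ≡ ∑Bools m d
∑Bools-cong zero    e = e []
∑Bools-cong (suc m) e = cong₂ _+_ (∑Bools-cong m (e ∘ (true ∷_))) (∑Bools-cong m (e ∘ (false ∷_)))

↔Fin-unique : A ↔ Fin m → A ↔ Fin n → m ≡ n
↔Fin-unique e e′ = ↔⇒≡ (↔-trans (↔-sym e) e′)

↔Fin-subst : m ≡ n → A ↔ Fin m → A ↔ Fin n
↔Fin-subst refl e = e

↔Fin-⊎ : A ↔ Fin a → B ↔ Fin b → (A ⊎ B) ↔ Fin (a + b)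
↔Fin-⊎ e e′ = ↔-trans (e ⊎-↔ e′) (↔-sym +↔⊎)

↔Fin-× : A ↔ Fin a → B ↔ Fin b → (A × B) ↔ Fin (a * b)
↔Fin-× e e′ = ↔-trans (e ×-↔ e′) (↔-sym *↔×)

↔Fin-T : ∀ b → T b ↔ Fin ⟦ b ⟧
↔Fin-T true  = ↔-sym 1↔⊤
↔Fin-T false = ↔-sym 0↔⊥

↔Fin-Maybe : A ↔ Fin a → Maybe A ↔ Fin (suc a)
↔Fin-Maybe e = mk↔ₛ′
  (λ { nothing → zero ; (just x) → suc (to e x) })
  (λ { zero → nothing ; (suc i) → just (from e i) })
  (λ { zero → refl ; (suc i) → cong suc (strictlyInverseˡ e i) })
  (λ { nothing → refl ; (just x) → cong just (strictlyInverseʳ e x) })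

Vec-suc-↔ : Vec A (suc m) ↔ (A × Vec A m)
Vec-suc-↔ = mk↔ₛ′ (λ { (x ∷ v) → x , v }) (λ (x , v) → x ∷ v) (λ _ → refl) (λ { (x ∷ v) → refl })

Σ-Vec-suc : {X : Vec A (suc m) → Set} → Σ (Vec A (suc m)) X ↔ Σ A (λ x → Σ (Vec A m) (λ v → X (x ∷ v)))
Σ-Vec-suc = mk↔ₛ′ (λ { (x ∷ v , p) → x , v , p }) (λ (x , v , p) → x ∷ v , p)
  (λ _ → refl) (λ { (_ ∷ _ , _) → refl })

↔Fin-Vec : ∀ m → A ↔ Fin a → Vec A m ↔ Fin (a ^ m)
↔Fin-Vec zero    e = mk↔ₛ′ (λ _ → zero) (λ _ → []) (λ { zero → refl }) (λ { [] → refl })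
↔Fin-Vec (suc m) e = ↔-trans Vec-suc-↔ (↔Fin-× e (↔Fin-Vec m e))

Vec-↔ : A ↔ B → Vec A m ↔ Vec B m
Vec-↔ e = mk↔ₛ′ (V.map (to e)) (V.map (from e))
  (λ v → trans (sym (Vecₚ.map-∘ (to e) (from e) v)) (trans (Vecₚ.map-cong (strictlyInverseˡ e) v) (Vecₚ.map-id v)))
  (λ v → trans (sym (Vecₚ.map-∘ (from e) (to e) v)) (trans (Vecₚ.map-cong (strictlyInverseʳ e) v) (Vecₚ.map-id v)))

↔Fin-ΣFin : ∀ n {X : Fin n → Set} (c : Fin n → ℕ) → (∀ i → X i ↔ Fin (c i)) → Σ (Fin n) X ↔ Fin (∑Fin n c)
↔Fin-ΣFin zero    c e = mk↔ₛ′ (λ ()) (λ ()) (λ ()) (λ ())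
↔Fin-ΣFin (suc n) c e = ↔-trans Σ-Fin-suc (↔Fin-⊎ (e zero) (↔Fin-ΣFin n (c ∘ suc) (e ∘ suc)))
  where
  Σ-Fin-suc : Σ (Fin (suc n)) _ ↔ (_ ⊎ Σ (Fin n) _)
  Σ-Fin-suc = mk↔ₛ′
    (λ { (zero , x) → inj₁ x ; (suc i , x) → inj₂ (i , x) })
    (λ { (inj₁ x) → zero , x ; (inj₂ (i , x)) → suc i , x })
    (λ { (inj₁ _) → refl ; (inj₂ _) → refl })
    (λ { (zero , _) → refl ; (suc _ , _) → refl })

↔Fin-ΣMaybe : ∀ n {X : Maybe (Fin n) → Set} (c : Maybe (Fin n) → ℕ) → (∀ x → X x ↔ Fin (c x)) →
  Σ (Maybe (Fin n)) X ↔ Fin (c nothing + ∑Fin n (c ∘ just))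
↔Fin-ΣMaybe n c e = ↔-trans Σ-Maybe (↔Fin-⊎ (e nothing) (↔Fin-ΣFin n (c ∘ just) (e ∘ just)))
  where
  Σ-Maybe : Σ (Maybe (Fin n)) _ ↔ (_ ⊎ Σ (Fin n) _)
  Σ-Maybe = mk↔ₛ′
    (λ { (nothing , x) → inj₁ x ; (just i , x) → inj₂ (i , x) })
    (λ { (inj₁ x) → nothing , x ; (inj₂ (i , x)) → just i , x })
    (λ { (inj₁ _) → refl ; (inj₂ _) → refl })
    (λ { (nothing , _) → refl ; (just _ , _) → refl })

↔Fin-ΣBools : ∀ m {X : Vec Bool m → Set} (c : Vec Bool m → ℕ) → (∀ s → X s ↔ Fin (c s)) →
  Σ (Vec Bool m) X ↔ Fin (∑Bools m c)
↔Fin-ΣBools zero    c e = ↔-trans (mk↔ₛ′ (λ { ([] , x) → x }) ([] ,_) (λ _ → refl) (λ { ([] , _) → refl })) (e [])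
↔Fin-ΣBools (suc m) c e = ↔-trans Σ-Bools-suc
  (↔Fin-⊎ (↔Fin-ΣBools m (c ∘ (true ∷_)) (e ∘ (true ∷_))) (↔Fin-ΣBools m (c ∘ (false ∷_)) (e ∘ (false ∷_))))
  where
  Σ-Bools-suc : Σ (Vec Bool (suc m)) _ ↔ (Σ (Vec Bool m) _ ⊎ Σ (Vec Bool m) _)
  Σ-Bools-suc = mk↔ₛ′
    (λ { (true ∷ s , x) → inj₁ (s , x) ; (false ∷ s , x) → inj₂ (s , x) })
    (λ { (inj₁ (s , x)) → true ∷ s , x ; (inj₂ (s , x)) → false ∷ s , x })
    (λ { (inj₁ _) → refl ; (inj₂ _) → refl })
    (λ { (true ∷ _ , _) → refl ; (false ∷ _ , _) → refl })

Σ-T-≡ : {P : A → Bool} {x y : Σ A (T ∘ P)} → proj₁ x ≡ proj₁ y → x ≡ y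
Σ-T-≡ {x = a , p} {.a , q} refl = cong (a ,_) (T-irrelevant p q)

Σ-T-transport : (e : A ↔ B) {P : A → Bool} {Q : B → Bool} → (∀ b → P (from e b) ≡ Q b) →
  Σ A (T ∘ P) ↔ Σ B (T ∘ Q)
Σ-T-transport e {P} {Q} P∘from≡Q = mk↔ₛ′
  (λ (a , p) → to e a , subst T (trans (cong P (sym (strictlyInverseʳ e a))) (P∘from≡Q (to e a))) p)
  (λ (b , q) → from e b , subst T (sym (P∘from≡Q b)) q)
  (λ (b , _) → Σ-T-≡ (strictlyInverseˡ e b))
  (λ (a , _) → Σ-T-≡ (strictlyInverseʳ e a))

Σ-T-cong : {P Q : A → Bool} → (∀ a → P a ≡ Q a) → Σ A (T ∘ P) ↔ Σ A (T ∘ Q)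
Σ-T-cong = Σ-T-transport ↔-refl

Σ-T-∧ : {P Q : A → Bool} → Σ A (λ a → T (P a ∧ Q a)) ↔ Σ (Σ A (T ∘ P)) (T ∘ Q ∘ proj₁)
Σ-T-∧ {P = P} = mk↔ₛ′
  (λ (a , pq) → let (p , q) = Equivalence.to (T-∧ {P a}) pq in (a , p) , q)
  (λ ((a , p) , q) → a , Equivalence.from T-∧ (p , q))
  (λ _ → Σ-T-≡ (Σ-T-≡ refl))
  (λ _ → Σ-T-≡ refl)

Σ-T-×ˡ : {P : A → Bool} → Σ (A × B) (T ∘ P ∘ proj₁) ↔ (Σ A (T ∘ P) × B)
Σ-T-×ˡ = mk↔ₛ′ (λ ((a , b) , p) → (a , p) , b) (λ ((a , p) , b) → (a , b) , p) (λ _ → refl) (λ _ → refl)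

Σ-T-×ʳ : {P : B → Bool} → Σ (A × B) (T ∘ P ∘ proj₂) ↔ (A × Σ B (T ∘ P))
Σ-T-×ʳ = mk↔ₛ′ (λ ((a , b) , p) → a , (b , p)) (λ (a , (b , p)) → (a , b) , p) (λ _ → refl) (λ _ → refl)

Σ-T-× : {P : A → Bool} {Q : B → Bool} → Σ (A × B) (λ (a , b) → T (P a ∧ Q b)) ↔ (Σ A (T ∘ P) × Σ B (T ∘ Q))
Σ-T-× {P = P} = mk↔ₛ′
  (λ ((a , b) , pq) → let (p , q) = Equivalence.to (T-∧ {P a}) pq in (a , p) , (b , q))
  (λ ((a , p) , (b , q)) → (a , b) , Equivalence.from T-∧ (p , q))
  (λ _ → cong₂ _,_ (Σ-T-≡ refl) (Σ-T-≡ refl))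
  (λ _ → Σ-T-≡ refl)


≡⇒≡ᵇ-true : a ≡ b → (a ≡ᵇ b) ≡ true
≡⇒≡ᵇ-true {a} {b} a≡b = Equivalence.to T-≡ (≡⇒≡ᵇ a b a≡b)

≡ᵇ-true⇒≡ : (a ≡ᵇ b) ≡ true → a ≡ b
≡ᵇ-true⇒≡ {a} {b} e = ≡ᵇ⇒≡ a b (Equivalence.from T-≡ e)

≢⇒≡ᵇ-false : a ≢ b → (a ≡ᵇ b) ≡ false
≢⇒≡ᵇ-false {a} {b} a≢b with a ≡ᵇ b in e
... | false = refl
... | true  = ⊥-elim (a≢b (≡ᵇ-true⇒≡ e))

≤⇒≤ᵇ-true : a ≤ b → (a ≤ᵇ b) ≡ true
≤⇒≤ᵇ-true a≤b = Equivalence.to T-≡ (≤⇒≤ᵇ a≤b)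

>⇒≤ᵇ-false : b < a → (a ≤ᵇ b) ≡ false
>⇒≤ᵇ-false {b} {a} b<a with a ≤ᵇ b in e
... | false = refl
... | true  = ⊥-elim (<⇒≱ b<a (≤ᵇ⇒≤ a b (Equivalence.from T-≡ e)))

≤ᵇ-strictMono : ∀ {f : Fin a → Fin b} → (∀ u x → toℕ u < toℕ x → toℕ (f u) < toℕ (f x)) →
  ∀ u x → (toℕ (f u) ≤ᵇ toℕ (f x)) ≡ (toℕ u ≤ᵇ toℕ x)
≤ᵇ-strictMono {f = f} mono u x with <-cmp (toℕ u) (toℕ x)
... | tri< u<x _ _ = trans (≤⇒≤ᵇ-true (<⇒≤ (mono u x u<x))) (sym (≤⇒≤ᵇ-true (<⇒≤ u<x)))
... | tri≈ _ u≡x _ rewrite toℕ-injective u≡x =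
  trans (≤⇒≤ᵇ-true (≤-refl {toℕ (f x)})) (sym (≤⇒≤ᵇ-true (≤-refl {toℕ x})))
... | tri> _ _ x<u = trans (>⇒≤ᵇ-false (mono x u x<u)) (sym (>⇒≤ᵇ-false x<u))

is-nothing⇒≡nothing : ∀ {x : Maybe A} → is-nothing x ≡ true → x ≡ nothing
is-nothing⇒≡nothing {x = nothing} _ = refl

is-nothing-map : ∀ {A B : Set} (f : A → B) x → is-nothing (Maybe.map f x) ≡ is-nothing x
is-nothing-map f nothing  = refl
is-nothing-map f (just _) = refl

countB-∷ : ∀ (P : A → Bool) x xs → countB P (x ∷ xs) ≡ ⟦ P x ⟧ + countB P xs
countB-∷ P x xs with P x
... | true  = refl
... | false = refl

countB≡sum : ∀ (P : A → Bool) xs → countB P xs ≡ sum (map (⟦_⟧ ∘ P) xs)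
countB≡sum P []       = refl
countB≡sum P (x ∷ xs) = trans (countB-∷ P x xs) (cong (⟦ P x ⟧ +_) (countB≡sum P xs))

countB-cong : ∀ {P Q : A → Bool} → (∀ x → P x ≡ Q x) → ∀ xs → countB P xs ≡ countB Q xs
countB-cong {P = P} {Q} e xs =
  trans (countB≡sum P xs) (trans (cong sum (map-cong (cong ⟦_⟧ ∘ e) xs)) (sym (countB≡sum Q xs)))

countB-false : ∀ {A : Set} {P : A → Bool} → (∀ x → P x ≡ false) → ∀ xs → countB P xs ≡ 0
countB-false {P = P} P≡false xs = trans (countB≡sum P xs) (sum-zero xs)
  where
  sum-zero : ∀ xs → sum (map (⟦_⟧ ∘ P) xs) ≡ 0
  sum-zero []       = refl
  sum-zero (x ∷ xs) rewrite P≡false x = sum-zero xs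

sum-tabulate : ∀ n {c : Fin n → ℕ} → sum (List.tabulate c) ≡ ∑Fin n c
sum-tabulate zero        = refl
sum-tabulate (suc n) {c} = cong (c zero +_) (sum-tabulate n)

countB-allFin : ∀ n (P : Fin n → Bool) → countB P (allFin n) ≡ ∑Fin n (⟦_⟧ ∘ P)
countB-allFin n P = trans (countB≡sum P (allFin n)) (trans (cong sum (map-tabulate (λ i → i) (⟦_⟧ ∘ P))) (sum-tabulate n))

countB-allFin-pos : ∀ {P : Fin n → Bool} i → P i ≡ true → 1 ≤ countB P (allFin n)
countB-allFin-pos {n} {P} i Pi≡true = subst (1 ≤_) (sym (countB-allFin n P))
  (≤-trans (subst (λ b → 1 ≤ ⟦ b ⟧) (sym Pi≡true) (s≤s z≤n)) (∑Fin-≥ n (⟦_⟧ ∘ P) i))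

countB-allFin-mono : ∀ {P Q : Fin n → Bool} → (∀ i → P i ≡ true → Q i ≡ true) →
  countB P (allFin n) ≤ countB Q (allFin n)
countB-allFin-mono {n} {P} {Q} P⇒Q = subst₂ _≤_ (sym (countB-allFin n P)) (sym (countB-allFin n Q))
  (∑Fin-mono n (λ i → ⟦⟧-mono (P⇒Q i)))

countB-allFin-≤ : ∀ (P : Fin n → Bool) → countB P (allFin n) ≤ n
countB-allFin-≤ {n} P = subst (_≤ n) (sym (countB-allFin n P)) (∑Fin-≤ n (⟦_⟧ ∘ P) (λ i → ⟦⟧≤1 (P i)))
  where
  ⟦⟧≤1 : ∀ b → ⟦ b ⟧ ≤ 1
  ⟦⟧≤1 false = z≤n
  ⟦⟧≤1 true  = s≤s z≤n

sum-concatMap : ∀ (w : B → ℕ) (h : A → List B) xs →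
  sum (map w (concatMap h xs)) ≡ sum (map (λ x → sum (map w (h x))) xs)
sum-concatMap w h []       = refl
sum-concatMap w h (x ∷ xs) = begin
  sum (map w (h x ++ concatMap h xs))              ≡⟨ cong sum (map-++ w (h x) (concatMap h xs)) ⟩
  sum (map w (h x) ++ map w (concatMap h xs))      ≡⟨ sum-++ (map w (h x)) _ ⟩
  sum (map w (h x)) + sum (map w (concatMap h xs)) ≡⟨ cong (_ +_) (sum-concatMap w h xs) ⟩
  _ ∎
  where open ≡-Reasoning

sum-map-+ : ∀ (v w : A → ℕ) xs → sum (map (λ x → v x + w x) xs) ≡ sum (map v xs) + sum (map w xs)
sum-map-+ v w []       = refl
sum-map-+ v w (x ∷ xs) = trans (cong (v x + w x +_) (sum-map-+ v w xs)) (interchange (v x) (w x) _ _)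

sum-map-swap : ∀ (w : A → B → ℕ) xs ys →
  sum (map (λ x → sum (map (w x) ys)) xs) ≡ sum (map (λ y → sum (map (λ x → w x y) xs)) ys)
sum-map-swap w []       ys = sym (sum-map-0 ys)
  where
  sum-map-0 : ∀ ys → sum (map (λ (_ : B) → 0) ys) ≡ 0
  sum-map-0 []       = refl
  sum-map-0 (_ ∷ ys) = sum-map-0 ys
sum-map-swap w (x ∷ xs) ys =
  trans (cong (sum (map (w x) ys) +_) (sum-map-swap w xs ys)) (sym (sum-map-+ (w x) _ ys))

allB-cong : {P Q : A → Bool} → (∀ x → P x ≡ Q x) → ∀ xs → allB P xs ≡ allB Q xs
allB-cong P≗Q []       = refl
allB-cong P≗Q (x ∷ xs) = cong₂ _∧_ (P≗Q x) (allB-cong P≗Q xs)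

allB-true : ∀ {P : A → Bool} → (∀ x → P x ≡ true) → ∀ xs → allB P xs ≡ true
allB-true P≡true []       = refl
allB-true P≡true (x ∷ xs) rewrite P≡true x = allB-true P≡true xs

allB-map : ∀ {B : Set} (f : B → Bool) (e : A → B) xs → allB f (map e xs) ≡ allB (f ∘ e) xs
allB-map f e []       = refl
allB-map f e (x ∷ xs) = cong (f (e x) ∧_) (allB-map f e xs)

module _ {P : A → Bool} where

  allB-tabulate⁺ : ∀ {n} (f : Fin n → A) → (∀ i → P (f i) ≡ true) → allB P (List.tabulate f) ≡ true
  allB-tabulate⁺ {zero}  f h = refl
  allB-tabulate⁺ {suc n} f h rewrite h zero = allB-tabulate⁺ (f ∘ suc) (h ∘ suc)

  allB-tabulate⁻ : ∀ {n} (f : Fin n → A) → allB P (List.tabulate f) ≡ true → ∀ i → P (f i) ≡ true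
  allB-tabulate⁻ f h zero    with P (f zero)
  ... | true = refl
  allB-tabulate⁻ f h (suc i) with P (f zero)
  ... | true = allB-tabulate⁻ (f ∘ suc) h i

any-map-false : ∀ {B : Set} {f : B → Bool} {e : A → B} → (∀ x → f (e x) ≡ false) → ∀ xs → any f (map e xs) ≡ false
any-map-false f∘e≡false []       = refl
any-map-false f∘e≡false (x ∷ xs) rewrite f∘e≡false x = any-map-false f∘e≡false xs


Respects≗ : ((Fin m → Maybe (Fin n)) → Bool) → Set
Respects≗ P = ∀ {f g} → f ≗ g → P f ≡ P g

countB-allMaps-suc : ∀ m n (P : (Fin (suc m) → Maybe (Fin n)) → Bool) →
  countB P (allMaps (suc m) n) ≡
  countB (P ∘ extend nothing) (allMaps m n) + ∑Fin n (λ i → countB (P ∘ extend (just i)) (allMaps m n))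
countB-allMaps-suc m n P = begin
  countB P (allMaps (suc m) n)
    ≡⟨ countB≡sum P (allMaps (suc m) n) ⟩
  sum (map (⟦_⟧ ∘ P) (concatMap (λ f → map (λ x → extend x f) (options n)) (allMaps m n)))
    ≡⟨ sum-concatMap (⟦_⟧ ∘ P) _ (allMaps m n) ⟩
  sum (map (λ f → sum (map (⟦_⟧ ∘ P) (map (λ x → extend x f) (options n)))) (allMaps m n))
    ≡⟨ cong sum (map-cong (λ f → cong sum (sym (map-∘ (options n)))) (allMaps m n)) ⟩
  sum (map (λ f → sum (map (λ x → ⟦ P (extend x f) ⟧) (options n))) (allMaps m n))
    ≡⟨ sum-map-swap (λ f x → ⟦ P (extend x f) ⟧) (allMaps m n) (options n) ⟩
  sum (map count (options n))
    ≡⟨ cong (count nothing +_) (cong sum (sym (map-∘ (allFin n)))) ⟩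
  count nothing + sum (map (count ∘ just) (allFin n))
    ≡⟨ cong (count nothing +_) (trans (cong sum (map-tabulate (λ i → i) (count ∘ just))) (sum-tabulate n)) ⟩
  count nothing + ∑Fin n (count ∘ just)
    ≡⟨ sym (cong₂ _+_ (countB≡sum _ (allMaps m n)) (∑Fin-cong n (λ i → countB≡sum _ (allMaps m n)))) ⟩
  countB (P ∘ extend nothing) (allMaps m n) + ∑Fin n (λ i → countB (P ∘ extend (just i)) (allMaps m n)) ∎
  where
  open ≡-Reasoning
  count : Maybe (Fin n) → ℕ
  count x = sum (map (λ f → ⟦ P (extend x f) ⟧) (allMaps m n))

↔Fin-allMaps : ∀ m n (P : (Fin m → Maybe (Fin n)) → Bool) → Respects≗ P →
  Σ (Vec (Maybe (Fin n)) m) (T ∘ P ∘ lookup) ↔ Fin (countB P (allMaps m n))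
↔Fin-allMaps zero n P resp = ↔Fin-subst (sym (trans (countB-∷ P _ []) (+-identityʳ _)))
  (↔-trans (mk↔ₛ′ (λ { ([] , p) → p }) ([] ,_) (λ _ → refl) (λ { ([] , _) → refl }))
           (subst (λ b → T b ↔ Fin ⟦ P (λ ()) ⟧) (resp (λ ())) (↔Fin-T (P (λ ())))))
↔Fin-allMaps (suc m) n P resp = ↔Fin-subst (sym (countB-allMaps-suc m n P))
  (↔-trans (Σ-T-cong {Q = λ v → P (extend (head v) (lookup (tail v)))} (λ { (x ∷ w) → resp (lookup-∷ x w) }))
  (↔-trans Σ-Vec-suc
  (↔Fin-ΣMaybe n (λ x → countB (P ∘ extend x) (allMaps m n))
    (λ x → ↔Fin-allMaps m n (P ∘ extend x) (resp ∘ extend-cong x)))))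
  where
  lookup-∷ : ∀ x (w : Vec (Maybe (Fin n)) m) → lookup (x ∷ w) ≗ extend x (lookup w)
  lookup-∷ x w zero    = refl
  lookup-∷ x w (suc i) = refl
  extend-cong : ∀ x {f g : Fin m → Maybe (Fin n)} → f ≗ g → extend x f ≗ extend x g
  extend-cong x f≗g zero    = refl
  extend-cong x f≗g (suc i) = f≗g i


-- Walks towards a root

reachesRoot-cong : {p q : ParentMap n} → p ≗ q → ∀ k u → reachesRoot k p u ≡ reachesRoot k q u
reachesRoot-cong         p≗q zero    u = refl
reachesRoot-cong {p = p} {q} p≗q (suc k) u with p u | q u | p≗q u
... | nothing | nothing | refl = refl
... | just w  | just .w | refl = reachesRoot-cong p≗q k w

path-cong : {p q : ParentMap n} → p ≗ q → ∀ k u → path k p u ≡ path k q u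
path-cong         p≗q zero    u = refl
path-cong {p = p} {q} p≗q (suc k) u with p u | q u | p≗q u
... | nothing | nothing | refl = refl
... | just w  | just .w | refl = cong (u ∷_) (path-cong p≗q k w)

isRootB-cong : {p q : ParentMap n} → p ≗ q → ∀ u → isRootB p u ≡ isRootB q u
isRootB-cong {p = p} {q} p≗q u with p u | q u | p≗q u
... | nothing | nothing | refl = refl
... | just _  | just _  | refl = refl

isForest-cong : {p q : ParentMap n} → p ≗ q → isForest p ≡ isForest q
isForest-cong {n} p≗q = allB-cong (reachesRoot-cong p≗q n) (allFin n)

isRecord-cong : {p q : ParentMap n} → p ≗ q → ∀ v → isRecord p v ≡ isRecord q v
isRecord-cong {n} p≗q v = cong (allB _) (path-cong p≗q n v)

records-cong : {p q : ParentMap n} → p ≗ q → records p ≡ records q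
records-cong {n} p≗q = countB-cong (isRecord-cong p≗q) (allFin n)

hasRecords-cong : ∀ k {p q : ParentMap n} → p ≗ q → hasRecords k p ≡ hasRecords k q
hasRecords-cong k p≗q = cong (_≡ᵇ k) (records-cong p≗q)

roots : ParentMap n → ℕ
roots {n} p = countB (isRootB p) (allFin n)

roots-cong : {p q : ParentMap n} → p ≗ q → roots p ≡ roots q
roots-cong {n} p≗q = countB-cong (isRootB-cong p≗q) (allFin n)

isRootB≡is-nothing : ∀ (p : ParentMap n) v → isRootB p v ≡ is-nothing (p v)
isRootB≡is-nothing p v with p v
... | nothing = refl
... | just _  = refl

module _ (p : ParentMap n) where

  reachesRoot-mono : ∀ {k k′} u → k ≤ k′ → reachesRoot k p u ≡ true → reachesRoot k′ p u ≡ true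
  reachesRoot-mono {suc k} {suc k′} u (s≤s k≤k′) h with p u
  ... | nothing = refl
  ... | just w  = reachesRoot-mono w k≤k′ h

  path-mono : ∀ {k k′} u → k ≤ k′ → reachesRoot k p u ≡ true → path k p u ≡ path k′ p u
  path-mono {suc k} {suc k′} u (s≤s k≤k′) h with p u
  ... | nothing = refl
  ... | just w  = cong (u ∷_) (path-mono w k≤k′ h)

  reachesRoot-parent : ∀ k {v w} → p v ≡ just w → reachesRoot (suc k) p v ≡ reachesRoot k p w
  reachesRoot-parent k {v} pv≡w with p v
  reachesRoot-parent k refl | just _ = refl

  reachesRoot-root : ∀ k {v} → p v ≡ nothing → reachesRoot (suc k) p v ≡ true
  reachesRoot-root k {v} pv≡nothing with p v
  reachesRoot-root k refl | nothing = refl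

  path-parent : ∀ k {v w} → p v ≡ just w → path (suc k) p v ≡ v ∷ path k p w
  path-parent k {v} pv≡w with p v
  path-parent k refl | just _ = refl

  path-root : ∀ k {v} → p v ≡ nothing → path (suc k) p v ≡ v ∷ []
  path-root k {v} pv≡nothing with p v
  path-root k refl | nothing = refl

  ancestor : ℕ → Fin n → Maybe (Fin n)
  ancestor zero    u = just u
  ancestor (suc k) u with p u
  ... | nothing = nothing
  ... | just w  = ancestor k w

  reachesRoot≡is-nothing : ∀ k u → reachesRoot k p u ≡ is-nothing (ancestor k u)
  reachesRoot≡is-nothing zero    u = refl
  reachesRoot≡is-nothing (suc k) u with p u
  ... | nothing = refl
  ... | just w  = reachesRoot≡is-nothing k w

  ancestor-+ : ∀ a b u → ancestor (a + b) u ≡ (ancestor a u >>= ancestor b)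
  ancestor-+ zero    b u = refl
  ancestor-+ (suc a) b u with p u
  ... | nothing = refl
  ... | just w  = ancestor-+ a b w

  ancestor-mono : ∀ {a b} u → a ≤ b → ancestor a u ≡ nothing → ancestor b u ≡ nothing
  ancestor-mono {a} {b} u a≤b h = begin
    ancestor b u                        ≡⟨ cong (λ c → ancestor c u) (sym (m+[n∸m]≡n a≤b)) ⟩
    ancestor (a + (b ∸ a)) u            ≡⟨ ancestor-+ a (b ∸ a) u ⟩
    (ancestor a u >>= ancestor (b ∸ a)) ≡⟨ cong (_>>= ancestor (b ∸ a)) h ⟩
    nothing                             ∎
    where open ≡-Reasoning

  -- Once the walk from u revisits a vertex it is periodic, so it never reaches a root.
  ancestor-recurrent : ∀ {i j} u → i < j → ancestor i u ≡ ancestor j u → ancestor j u ≢ nothing →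
    ∀ t → ancestor t u ≢ nothing
  ancestor-recurrent {i} {j} u i<j ai≡aj aj≢nothing = <-rec _ go
    where
    go : ∀ t → (∀ {t′} → t′ < t → ancestor t′ u ≢ nothing) → ancestor t u ≢ nothing
    go t rec with t ≤? j
    ... | yes t≤j = aj≢nothing ∘ ancestor-mono u t≤j
    ... | no  t≰j = λ at≡nothing → rec i+r<t (begin
        ancestor (i + r) u            ≡⟨ ancestor-+ i r u ⟩
        (ancestor i u >>= ancestor r) ≡⟨ cong (_>>= ancestor r) ai≡aj ⟩
        (ancestor j u >>= ancestor r) ≡⟨ sym (ancestor-+ j r u) ⟩
        ancestor (j + r) u            ≡⟨ cong (λ c → ancestor c u) j+r≡t ⟩
        ancestor t u                  ≡⟨ at≡nothing ⟩
        nothing                       ∎)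
      where
      open ≡-Reasoning
      r = t ∸ j
      j+r≡t : j + r ≡ t
      j+r≡t = m+[n∸m]≡n (<⇒≤ (≰⇒> t≰j))
      i+r<t : i + r < t
      i+r<t = subst (i + r <_) j+r≡t (+-monoˡ-< r i<j)

  reachesRoot⇒ancestor≡nothing : ∀ k u → reachesRoot k p u ≡ true → ancestor k u ≡ nothing
  reachesRoot⇒ancestor≡nothing k u h = is-nothing⇒≡nothing (trans (sym (reachesRoot≡is-nothing k u)) h)

  ancestor-parent : ∀ t {v w} → p v ≡ just w → ancestor (suc t) v ≡ ancestor t w
  ancestor-parent t {v} pv≡w with p v
  ancestor-parent t refl | just _ = refl

  reachesRoot-within : ∀ K u → reachesRoot K p u ≡ true → reachesRoot n p u ≡ true
  reachesRoot-within K u h with ancestor n u in an≡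
  ... | nothing = trans (reachesRoot≡is-nothing n u) (cong is-nothing an≡)
  ... | just w  = ⊥-elim (ancestor-recurrent u i<j ai≡aj (a≢nothing J≤n) K (reachesRoot⇒ancestor≡nothing K u h))
    where
    a≢nothing : ∀ {t} → t ≤ n → ancestor t u ≢ nothing
    a≢nothing t≤n at≡nothing = case trans (sym an≡) (ancestor-mono u t≤n at≡nothing) of λ ()
    walk : Fin (suc n) → Fin n
    walk t = fromMaybe u (ancestor (toℕ t) u)
    collision = pigeonhole (n<1+n n) walk
    I = toℕ (proj₁ collision)
    J = toℕ (proj₁ (proj₂ collision))
    i<j : I < J
    i<j = proj₁ (proj₂ (proj₂ collision))
    J≤n : J ≤ n
    J≤n = ≤-pred (toℕ<n (proj₁ (proj₂ collision)))
    just-walk : ∀ {t} → t ≤ n → ancestor t u ≡ just (fromMaybe u (ancestor t u))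
    just-walk {t} t≤n with ancestor t u in at≡
    ... | just x  = refl
    ... | nothing = ⊥-elim (a≢nothing t≤n at≡)
    ai≡aj : ancestor I u ≡ ancestor J u
    ai≡aj = trans (just-walk (≤-trans (<⇒≤ i<j) J≤n))
              (trans (cong just (proj₂ (proj₂ (proj₂ collision)))) (sym (just-walk J≤n)))

  ancestor-of-path : ∀ K {w v} → any (λ u → toℕ u ≡ᵇ toℕ v) (path K p w) ≡ true → ∃ λ t → ancestor t w ≡ just v
  ancestor-of-path (suc K) {w} {v} h with p w in pw
  ... | nothing with toℕ w ≡ᵇ toℕ v in w≡v
  ...   | true  = 0 , cong just (toℕ-injective (≡ᵇ-true⇒≡ w≡v))
  ancestor-of-path (suc K) {w} {v} h | just w′ with toℕ w ≡ᵇ toℕ v in w≡v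
  ...   | true  = 0 , cong just (toℕ-injective (≡ᵇ-true⇒≡ w≡v))
  ...   | false = let (t , at≡v) = ancestor-of-path K h in suc t , trans (ancestor-parent t pw) at≡v

any-path-head : ∀ (p : ParentMap n) {f : Fin n → Bool} {K v} → f v ≡ true → any f (path (suc K) p v) ≡ true
any-path-head p {v = v} fv≡true with p v
... | nothing rewrite fv≡true = refl
... | just _  rewrite fv≡true = refl

root-exists : ∀ (p : ParentMap n) k u → reachesRoot k p u ≡ true → Σ (Fin n) (λ r → p r ≡ nothing)
root-exists p (suc k) u h with p u in pu
... | nothing = u , pu
... | just w  = root-exists p k w h

IsForest : ParentMap n → Set
IsForest {n} p = ∀ u → reachesRoot n p u ≡ true

isForest⇒IsForest : {p : ParentMap n} → isForest p ≡ true → IsForest p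
isForest⇒IsForest = allB-tabulate⁻ (λ u → u)

IsForest⇒isForest : {p : ParentMap n} → IsForest p → isForest p ≡ true
IsForest⇒isForest = allB-tabulate⁺ (λ u → u)

module Simulation {a b} {p : ParentMap a} {p′ : ParentMap b} (e : Fin a → Fin b)
                  (commutes : ∀ x → p′ (e x) ≡ Maybe.map e (p x)) where

  reachesRoot-sim : ∀ k x → reachesRoot k p′ (e x) ≡ reachesRoot k p x
  reachesRoot-sim zero    x = refl
  reachesRoot-sim (suc k) x with p′ (e x) | p x | commutes x
  ... | nothing | nothing | refl = refl
  ... | just _  | just w  | refl = reachesRoot-sim k w

  path-sim : ∀ k x → path k p′ (e x) ≡ map e (path k p x)
  path-sim zero    x = refl
  path-sim (suc k) x with p′ (e x) | p x | commutes x
  ... | nothing | nothing | refl = refl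
  ... | just _  | just w  | refl = cong (e x ∷_) (path-sim k w)

module _ {p : ParentMap n} (forest : IsForest p) where

  forest-path-parent : ∀ {v w} → p v ≡ just w → path n p v ≡ v ∷ path n p w
  forest-path-parent {v} pv≡w = trans (path-mono p v (n≤1+n n) (forest v)) (path-parent p n pv≡w)

  parent-not-descendant : ∀ {v w} → p v ≡ just w → any (λ u → toℕ u ≡ᵇ toℕ v) (path n p w) ≡ false
  parent-not-descendant {v} {w} pv≡w with any (λ u → toℕ u ≡ᵇ toℕ v) (path n p w) in v-below-w
  ... | false = refl
  ... | true  = ⊥-elim (ancestor-recurrent p v (s≤s z≤n) (sym cycle) (λ e → case trans (sym cycle) e of λ ())
                          n (reachesRoot⇒ancestor≡nothing p n v (forest v)))
    where
    cycle : ancestor p (suc (proj₁ (ancestor-of-path p n v-below-w))) v ≡ just v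
    cycle = trans (ancestor-parent p _ pv≡w) (proj₂ (ancestor-of-path p n v-below-w))

  forest-path-root : ∀ {v} → p v ≡ nothing → path n p v ≡ v ∷ []
  forest-path-root {v} pv≡nothing = trans (path-mono p v (n≤1+n n) (forest v)) (path-root p n pv≡nothing)

isRecord-max : ∀ (p : ParentMap (suc m)) → isRecord p (fromℕ m) ≡ true
isRecord-max {m} p =
  allB-true (λ u → ≤⇒≤ᵇ-true (subst (toℕ u ≤_) (sym (toℕ-fromℕ m)) (≤-pred (toℕ<n u)))) (path (suc m) p (fromℕ m))

roots-pos : ∀ {p : ParentMap (suc n)} → IsForest p → 1 ≤ roots p
roots-pos {n} {p} forest = let (r , pr≡nothing) = root-exists p (suc n) zero (forest zero) in
  countB-allFin-pos {P = isRootB p} r (trans (isRootB≡is-nothing p r) (cong is-nothing pr≡nothing))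

records-pos : ∀ (p : ParentMap (suc n)) → 1 ≤ records p
records-pos {n} p = countB-allFin-pos {P = isRecord p} (fromℕ n) (isRecord-max p)

records-≤ : ∀ (p : ParentMap n) → records p ≤ n
records-≤ p = countB-allFin-≤ (isRecord p)

root-isRecord : ∀ (p : ParentMap n) v → isRootB p v ≡ true → isRecord p v ≡ true
root-isRecord {suc n} p v v-root =
  trans (cong (allB _) (path-root p n pv≡nothing)) (cong (_∧ true) (≤⇒≤ᵇ-true (≤-refl {toℕ v})))
  where
  pv≡nothing : p v ≡ nothing
  pv≡nothing = is-nothing⇒≡nothing (trans (sym (isRootB≡is-nothing p v)) v-root)

roots≤records : ∀ (p : ParentMap n) → roots p ≤ records p
roots≤records p = countB-allFin-mono (root-isRecord p)


trues : Vec Bool m → ℕ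
trues []          = 0
trues (true ∷ s)  = suc (trues s)
trues (false ∷ s) = trues s

falses : Vec Bool m → ℕ
falses []          = 0
falses (true ∷ s)  = falses s
falses (false ∷ s) = suc (falses s)

trues+falses : (s : Vec Bool m) → trues s + falses s ≡ m
trues+falses []          = refl
trues+falses (true ∷ s)  = cong suc (trues+falses s)
trues+falses (false ∷ s) = trans (+-suc (trues s) (falses s)) (cong suc (trues+falses s))

-- s : Vec Bool m encodes a subset of Fin m; merge s lists its members (inj₁) and the other elements (inj₂)
-- in increasing order.
merge : (s : Vec Bool m) → Fin (trues s) ⊎ Fin (falses s) → Fin m
merge (true ∷ s)  (inj₁ zero)    = zero
merge (true ∷ s)  (inj₁ (suc x)) = suc (merge s (inj₁ x))
merge (true ∷ s)  (inj₂ y)       = suc (merge s (inj₂ y))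
merge (false ∷ s) (inj₁ x)       = suc (merge s (inj₁ x))
merge (false ∷ s) (inj₂ zero)    = zero
merge (false ∷ s) (inj₂ (suc y)) = suc (merge s (inj₂ y))

split : (s : Vec Bool m) → Fin m → Fin (trues s) ⊎ Fin (falses s)
split (true ∷ s)  zero    = inj₁ zero
split (true ∷ s)  (suc i) = Sum.map suc id (split s i)
split (false ∷ s) zero    = inj₂ zero
split (false ∷ s) (suc i) = Sum.map id suc (split s i)

split-merge : (s : Vec Bool m) → ∀ z → split s (merge s z) ≡ z
split-merge (true ∷ s)  (inj₁ zero)    = refl
split-merge (true ∷ s)  (inj₁ (suc x)) = cong (Sum.map suc id) (split-merge s (inj₁ x))
split-merge (true ∷ s)  (inj₂ y)       = cong (Sum.map suc id) (split-merge s (inj₂ y))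
split-merge (false ∷ s) (inj₁ x)       = cong (Sum.map id suc) (split-merge s (inj₁ x))
split-merge (false ∷ s) (inj₂ zero)    = refl
split-merge (false ∷ s) (inj₂ (suc y)) = cong (Sum.map id suc) (split-merge s (inj₂ y))

merge-split : (s : Vec Bool m) → ∀ i → merge s (split s i) ≡ i
merge-split (true ∷ s)  zero    = refl
merge-split (true ∷ s)  (suc i) with split s i | merge-split s i
... | inj₁ _ | e = cong suc e
... | inj₂ _ | e = cong suc e
merge-split (false ∷ s) zero    = refl
merge-split (false ∷ s) (suc i) with split s i | merge-split s i
... | inj₁ _ | e = cong suc e
... | inj₂ _ | e = cong suc e

lookup-merge₁ : (s : Vec Bool m) → ∀ x → lookup s (merge s (inj₁ x)) ≡ true
lookup-merge₁ (true ∷ s)  zero    = refl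
lookup-merge₁ (true ∷ s)  (suc x) = lookup-merge₁ s x
lookup-merge₁ (false ∷ s) x       = lookup-merge₁ s x

lookup-merge₂ : (s : Vec Bool m) → ∀ y → lookup s (merge s (inj₂ y)) ≡ false
lookup-merge₂ (true ∷ s)  y       = lookup-merge₂ s y
lookup-merge₂ (false ∷ s) zero    = refl
lookup-merge₂ (false ∷ s) (suc y) = lookup-merge₂ s y

merge₁-strictMono : (s : Vec Bool m) → ∀ x y → toℕ x < toℕ y → toℕ (merge s (inj₁ x)) < toℕ (merge s (inj₁ y))
merge₁-strictMono (true ∷ s)  zero    (suc y) _         = s≤s z≤n
merge₁-strictMono (true ∷ s)  (suc x) (suc y) (s≤s x<y) = s≤s (merge₁-strictMono s x y x<y)
merge₁-strictMono (false ∷ s) x       y       x<y       = s≤s (merge₁-strictMono s x y x<y)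

data Side (s : Vec Bool m) : Fin m → Set where
  onTrue  : ∀ x → Side s (merge s (inj₁ x))
  onFalse : ∀ y → Side s (merge s (inj₂ y))

side : (s : Vec Bool m) → ∀ w → Side s w
side s w = subst (Side s) (merge-split s w) (side′ (split s w))
  where
  side′ : ∀ z → Side s (merge s z)
  side′ (inj₁ x) = onTrue x
  side′ (inj₂ y) = onFalse y

∑Fin-merge : ∀ (s : Vec Bool m) (c : Fin m → ℕ) →
  ∑Fin m c ≡ ∑Fin (trues s) (c ∘ merge s ∘ inj₁) + ∑Fin (falses s) (c ∘ merge s ∘ inj₂)
∑Fin-merge []          c = refl
∑Fin-merge (true ∷ s)  c = trans (cong (c zero +_) (∑Fin-merge s (c ∘ suc))) (sym (+-assoc (c zero) _ _))
∑Fin-merge (false ∷ s) c = trans (cong (c zero +_) (∑Fin-merge s (c ∘ suc)))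
  (x∙yz≈y∙xz (c zero) (∑Fin (trues s) (c ∘ suc ∘ merge s ∘ inj₁)) (∑Fin (falses s) (c ∘ suc ∘ merge s ∘ inj₂)))


-- Removing the maximal vertex

dropMax : Fin (suc m) → Maybe (Fin m)
dropMax {zero}  zero    = nothing
dropMax {suc m} zero    = just zero
dropMax {suc m} (suc v) = Maybe.map suc (dropMax v)

addMax : Maybe (Fin m) → Fin (suc m)
addMax {m} nothing = fromℕ m
addMax (just w)    = inject₁ w

dropMax-addMax : ∀ (z : Maybe (Fin m)) → dropMax (addMax z) ≡ z
dropMax-addMax {zero}  nothing        = refl
dropMax-addMax {suc m} nothing        = cong (Maybe.map suc) (dropMax-addMax {m} nothing)
dropMax-addMax {suc m} (just zero)    = refl
dropMax-addMax {suc m} (just (suc w)) = cong (Maybe.map suc) (dropMax-addMax (just w))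

addMax-dropMax : ∀ (v : Fin (suc m)) → addMax (dropMax v) ≡ v
addMax-dropMax {zero}  zero    = refl
addMax-dropMax {suc m} zero    = refl
addMax-dropMax {suc m} (suc v) with dropMax v | addMax-dropMax v
... | nothing | e = cong suc e
... | just _  | e = cong suc e

isMax : Fin (suc m) → Bool
isMax {m} u = toℕ u ≡ᵇ m

isMax-max : isMax (fromℕ m) ≡ true
isMax-max {m} = ≡⇒≡ᵇ-true (toℕ-fromℕ m)

isMax-inject₁ : ∀ (w : Fin m) → isMax (inject₁ w) ≡ false
isMax-inject₁ w = ≢⇒≡ᵇ-false (<⇒≢ (subst (_< _) (sym (toℕ-inject₁ w)) (toℕ<n w)))

inMaxSubtree : ParentMap (suc m) → Fin (suc m) → Bool
inMaxSubtree {m} p v = any isMax (path (suc m) p v)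

outsideMaxSubtree : ParentMap (suc m) → Vec Bool m
outsideMaxSubtree p = tabulate (not ∘ inMaxSubtree p ∘ inject₁)

allB-≤ᵇ-below-max : ∀ (v : Fin (suc m)) → toℕ v < m →
  ∀ us → any (isMax {m}) us ≡ true → allB (λ u → toℕ u ≤ᵇ toℕ v) us ≡ false
allB-≤ᵇ-below-max {m} v v<m (u ∷ us) max∈us with isMax u in u-max
... | true  = cong (_∧ _) (trans (cong (_≤ᵇ toℕ v) (≡ᵇ-true⇒≡ {toℕ u} {m} u-max)) (>⇒≤ᵇ-false v<m))
... | false rewrite allB-≤ᵇ-below-max v v<m us max∈us = ∧-zeroʳ _

-- s splits the vertices other than the maximum into L- and R-vertices; a forest p is decomposed along
-- s = outsideMaxSubtree p, so that the R-vertices are the proper descendants of the maximum.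
module Decomposition {m : ℕ} (s : Vec Bool m) where

  I J : ℕ
  I = trues s
  J = falses s

  max : Fin (suc m)
  max = fromℕ m

  L : Fin I → Fin (suc m)
  L = inject₁ ∘ merge s ∘ inj₁

  R : Fin J → Fin (suc m)
  R = inject₁ ∘ merge s ∘ inj₂

  isMax-L : ∀ x → isMax (L x) ≡ false
  isMax-L x = isMax-inject₁ (merge s (inj₁ x))

  isMax-R : ∀ y → isMax (R y) ≡ false
  isMax-R y = isMax-inject₁ (merge s (inj₂ y))

  data Position : Fin (suc m) → Set where
    atL   : ∀ x → Position (L x)
    atR   : ∀ y → Position (R y)
    atMax : Position max

  position : ∀ v → Position v
  position v = subst Position (addMax-dropMax v) (classify (dropMax v))
    where
    classify : ∀ z → Position (addMax z)
    classify nothing  = atMax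
    classify (just w) with side s w
    ... | onTrue x  = atL x
    ... | onFalse y = atR y

  -- The roots of the forest on the R-part become the children of the maximum.
  attachR : Maybe (Fin J) → Maybe (Fin (suc m))
  attachR nothing  = just max
  attachR (just y) = just (R y)

  glue : ParentMap I → ParentMap J → Maybe (Fin I) → ParentMap (suc m)
  glue q g a v with dropMax v
  ... | nothing = Maybe.map L a
  ... | just w  = Sum.[ Maybe.map L ∘ q , attachR ∘ g ] (split s w)

  indexL : Fin (suc m) → Maybe (Fin I)
  indexL v = dropMax v >>= Sum.[ just , const nothing ] ∘ split s

  indexR : Fin (suc m) → Maybe (Fin J)
  indexR v = dropMax v >>= Sum.[ const nothing , just ] ∘ split s

  restrictL : ParentMap (suc m) → ParentMap I
  restrictL p x = p (L x) >>= indexL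

  restrictR : ParentMap (suc m) → ParentMap J
  restrictR p y = p (R y) >>= indexR

  parentOfMax : ParentMap (suc m) → Maybe (Fin I)
  parentOfMax p = p max >>= indexL

  dropMax-L : ∀ x → dropMax (L x) ≡ just (merge s (inj₁ x))
  dropMax-L x = dropMax-addMax (just _)

  dropMax-R : ∀ y → dropMax (R y) ≡ just (merge s (inj₂ y))
  dropMax-R y = dropMax-addMax (just _)

  dropMax-max : dropMax max ≡ nothing
  dropMax-max = dropMax-addMax {m} nothing

  countB-positions : ∀ (f : Fin (suc m) → Bool) →
    countB f (allFin (suc m)) ≡ (∑Fin I (⟦_⟧ ∘ f ∘ L) + ∑Fin J (⟦_⟧ ∘ f ∘ R)) + ⟦ f max ⟧
  countB-positions f = trans (countB-allFin (suc m) f)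
    (trans (∑Fin-last m (⟦_⟧ ∘ f)) (cong (_+ ⟦ f max ⟧) (∑Fin-merge s (⟦_⟧ ∘ f ∘ inject₁))))

  module _ (q : ParentMap I) (g : ParentMap J) (a : Maybe (Fin I)) where

    glue-L : ∀ x → glue q g a (L x) ≡ Maybe.map L (q x)
    glue-L x rewrite dropMax-L x | split-merge s (inj₁ x) = refl

    glue-R : ∀ y → glue q g a (R y) ≡ attachR (g y)
    glue-R y rewrite dropMax-R y | split-merge s (inj₂ y) = refl

    glue-max : glue q g a max ≡ Maybe.map L a
    glue-max rewrite dropMax-max = refl

  indexL-L : ∀ x → indexL (L x) ≡ just x
  indexL-L x rewrite dropMax-L x | split-merge s (inj₁ x) = refl

  indexR-R : ∀ y → indexR (R y) ≡ just y
  indexR-R y rewrite dropMax-R y | split-merge s (inj₂ y) = refl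

  indexR-max : indexR max ≡ nothing
  indexR-max rewrite dropMax-max = refl

  module Glue (q : ParentMap I) (g : ParentMap J) (a : Maybe (Fin I)) where

    P : ParentMap (suc m)
    P = glue q g a

    open Simulation {p = q} {p′ = P} L (glue-L q g a) public

    inMaxSubtree-L : ∀ x → inMaxSubtree P (L x) ≡ false
    inMaxSubtree-L x = trans (cong (any isMax) (path-sim (suc m) x)) (any-map-false {f = isMax} {e = L} isMax-L (path (suc m) q x))

    reachesMax-R : ∀ k y → reachesRoot k g y ≡ true → ∀ t → any isMax (path (k + suc t) P (R y)) ≡ true
    reachesMax-R (suc k) y h t with g y in gy
    ... | nothing = trans (cong (any isMax) (path-parent P _ (trans (glue-R q g a y) (cong attachR gy))))
                          (trans (cong (isMax (R y) ∨_) max-on-path) (∨-zeroʳ _))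
      where
      max-on-path : any isMax (path (k + suc t) P max) ≡ true
      max-on-path = subst (λ c → any isMax (path c P max) ≡ true) (sym (+-suc k t)) (any-path-head P (isMax-max {m}))
    ... | just y′ = trans (cong (any isMax) (path-parent P _ (trans (glue-R q g a y) (cong attachR gy))))
                          (trans (cong (isMax (R y) ∨_) (reachesMax-R k y′ h t)) (∨-zeroʳ _))

    inMaxSubtree-R : IsForest g → ∀ y → inMaxSubtree P (R y) ≡ true
    inMaxSubtree-R forest-g y =
      subst (λ c → any isMax (path c P (R y)) ≡ true) J+1+I≡1+m (reachesMax-R J y (forest-g y) I)
      where
      J+1+I≡1+m : J + suc I ≡ suc m
      J+1+I≡1+m = trans (+-suc J I) (cong suc (trans (+-comm J I) (trues+falses s)))

    outsideMaxSubtree-glue : IsForest g → outsideMaxSubtree P ≡ s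
    outsideMaxSubtree-glue forest-g = trans (tabulate-cong outside≡s) (tabulate∘lookup s)
      where
      outside≡s : ∀ w → not (inMaxSubtree P (inject₁ w)) ≡ lookup s w
      outside≡s w with side s w
      ... | onTrue x  = trans (cong not (inMaxSubtree-L x)) (sym (lookup-merge₁ s x))
      ... | onFalse y = trans (cong not (inMaxSubtree-R forest-g y)) (sym (lookup-merge₂ s y))

    restrictL-glue : ∀ x → restrictL P x ≡ q x
    restrictL-glue x rewrite glue-L q g a x with q x
    ... | nothing = refl
    ... | just x′ = indexL-L x′

    restrictR-glue : ∀ y → restrictR P y ≡ g y
    restrictR-glue y rewrite glue-R q g a y with g y
    ... | nothing = indexR-max
    ... | just y′ = indexR-R y′

    parentOfMax-glue : parentOfMax P ≡ a
    parentOfMax-glue = trans (cong (_>>= indexL) (glue-max q g a)) (indexL-map-L a)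
      where
      indexL-map-L : ∀ a′ → (Maybe.map L a′ >>= indexL) ≡ a′
      indexL-map-L nothing   = refl
      indexL-map-L (just x) = indexL-L x

  module Restrict (p : ParentMap (suc m)) (forest : IsForest p) (outside≡s : outsideMaxSubtree p ≡ s) where

    lookup-outside : ∀ w → lookup s w ≡ not (inMaxSubtree p (inject₁ w))
    lookup-outside w = trans (cong (λ s′ → lookup s′ w) (sym outside≡s)) (lookup∘tabulate _ w)

    inMaxSubtree-L : ∀ x → inMaxSubtree p (L x) ≡ false
    inMaxSubtree-L x = not-injective (trans (sym (lookup-outside _)) (lookup-merge₁ s x))

    inMaxSubtree-R : ∀ y → inMaxSubtree p (R y) ≡ true
    inMaxSubtree-R y = not-injective (trans (sym (lookup-outside _)) (lookup-merge₂ s y))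

    inMaxSubtree-max : inMaxSubtree p max ≡ true
    inMaxSubtree-max = any-path-head p (isMax-max {m})

    inMaxSubtree-parent : ∀ {v u} → p v ≡ just u → isMax v ≡ false → inMaxSubtree p v ≡ inMaxSubtree p u
    inMaxSubtree-parent {u = u} pv≡u v-not-max =
      trans (cong (any isMax) (forest-path-parent {p = p} forest pv≡u)) (cong (_∨ inMaxSubtree p u) v-not-max)

    -- The parent of the maximum lies outside its subtree, otherwise they would form a cycle.
    inMaxSubtree-parent-max : ∀ {u} → p max ≡ just u → inMaxSubtree p u ≡ false
    inMaxSubtree-parent-max pmax≡u =
      subst (λ c → any (λ z → toℕ z ≡ᵇ c) (path (suc m) p _) ≡ false) (toℕ-fromℕ m)
            (parent-not-descendant {p = p} forest pmax≡u)

    L-indexL : ∀ {u} → inMaxSubtree p u ≡ false → Maybe.map L (indexL u) ≡ just u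
    L-indexL {u} u∉ with position u
    ... | atL x = cong (Maybe.map L) (indexL-L x)
    ... | atR y = case trans (sym u∉) (inMaxSubtree-R y) of λ ()
    ... | atMax = case trans (sym u∉) inMaxSubtree-max of λ ()

    attachR-indexR : ∀ {u} → inMaxSubtree p u ≡ true → attachR (indexR u) ≡ just u
    attachR-indexR {u} u∈ with position u
    ... | atL x = case trans (sym u∈) (inMaxSubtree-L x) of λ ()
    ... | atR y = cong attachR (indexR-R y)
    ... | atMax = cong attachR indexR-max

    glue-restrict : glue (restrictL p) (restrictR p) (parentOfMax p) ≗ p
    glue-restrict v with position v
    ... | atL x = trans (glue-L _ _ _ x) (parent-L (p (L x)) refl)
      where
      parent-L : ∀ z → p (L x) ≡ z → Maybe.map L (z >>= indexL) ≡ z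
      parent-L nothing  _      = refl
      parent-L (just u) pLx≡u = L-indexL (trans (sym (inMaxSubtree-parent pLx≡u (isMax-L x))) (inMaxSubtree-L x))
    ... | atR y = trans (glue-R _ _ _ y) (parent-R (p (R y)) refl)
      where
      parent-R : ∀ z → p (R y) ≡ z → attachR (z >>= indexR) ≡ z
      parent-R nothing  pRy≡nothing =
        case trans (sym (inMaxSubtree-R y))
                   (trans (cong (any isMax) (forest-path-root {p = p} forest pRy≡nothing)) (cong (_∨ false) (isMax-R y))) of λ ()
      parent-R (just u) pRy≡u = attachR-indexR (trans (sym (inMaxSubtree-parent pRy≡u (isMax-R y))) (inMaxSubtree-R y))
    ... | atMax = trans (glue-max _ _ _) (parent-max (p max) refl)
      where
      parent-max : ∀ z → p max ≡ z → Maybe.map L (z >>= indexL) ≡ z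
      parent-max nothing  _        = refl
      parent-max (just u) pmax≡u = L-indexL (inMaxSubtree-parent-max pmax≡u)

    restrict-commutes : ∀ x → p (L x) ≡ Maybe.map L (restrictL p x)
    restrict-commutes x = trans (sym (glue-restrict (L x))) (glue-L _ _ _ x)

    restrictL-IsForest : IsForest (restrictL p)
    restrictL-IsForest x = reachesRoot-within (restrictL p) (suc m) x (trans (sym (reachesRoot-sim (suc m) x)) (forest (L x)))
      where open Simulation {p = restrictL p} {p′ = p} L restrict-commutes

    restrictR-reaches : ∀ k y → reachesRoot k p (R y) ≡ true → reachesRoot k (restrictR p) y ≡ true
    restrictR-reaches (suc k) y h with restrictR p y in gy
    ... | nothing = refl
    ... | just y′ = restrictR-reaches k y′ (trans (sym (reachesRoot-parent p k pRy≡Ry′)) h)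
      where
      pRy≡Ry′ : p (R y) ≡ just (R y′)
      pRy≡Ry′ = trans (sym (glue-restrict (R y))) (trans (glue-R _ _ _ y) (cong attachR gy))

    restrictR-IsForest : IsForest (restrictR p)
    restrictR-IsForest y = reachesRoot-within (restrictR p) (suc m) y (restrictR-reaches (suc m) y (forest (R y)))

  module GlueForests (q : ParentMap I) (g : ParentMap J) (a : Maybe (Fin I))
                     (forest-q : IsForest q) (forest-g : IsForest g) where

    open Glue q g a

    I≤m : I ≤ m
    I≤m = subst (I ≤_) (trues+falses s) (m≤m+n I J)

    reachesRoot-L : ∀ x → reachesRoot (suc m) P (L x) ≡ true
    reachesRoot-L x = trans (reachesRoot-sim (suc m) x) (reachesRoot-mono q x (m≤n⇒m≤1+n I≤m) (forest-q x))

    reachesRoot-max : reachesRoot (suc I) P max ≡ true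
    reachesRoot-max = reaches a (glue-max q g a)
      where
      reaches : ∀ z → P max ≡ Maybe.map L z → reachesRoot (suc I) P max ≡ true
      reaches nothing  Pmax≡z = reachesRoot-root P I Pmax≡z
      reaches (just x) Pmax≡z = trans (reachesRoot-parent P I Pmax≡z) (trans (reachesRoot-sim I x) (forest-q x))

    reachesRoot-R : ∀ k y → reachesRoot k g y ≡ true → reachesRoot (k + suc I) P (R y) ≡ true
    reachesRoot-R (suc k) y h with g y in gy
    ... | nothing = trans (reachesRoot-parent P _ (trans (glue-R q g a y) (cong attachR gy)))
                          (reachesRoot-mono P max (m≤n+m (suc I) k) reachesRoot-max)
    ... | just y′ = trans (reachesRoot-parent P _ (trans (glue-R q g a y) (cong attachR gy))) (reachesRoot-R k y′ h)

    glue-IsForest : IsForest P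
    glue-IsForest v with position v
    ... | atL x = reachesRoot-L x
    ... | atR y = reachesRoot-within P (J + suc I) (R y) (reachesRoot-R J y (forest-g y))
    ... | atMax = reachesRoot-within P (suc I) max reachesRoot-max

    isRecord-L : ∀ x → isRecord P (L x) ≡ isRecord q x
    isRecord-L x = begin
      allB (λ u → toℕ u ≤ᵇ toℕ (L x)) (path (suc m) P (L x))
        ≡⟨ cong (allB _) (path-sim (suc m) x) ⟩
      allB (λ u → toℕ u ≤ᵇ toℕ (L x)) (map L (path (suc m) q x))
        ≡⟨ allB-map _ L (path (suc m) q x) ⟩
      allB (λ u → toℕ (L u) ≤ᵇ toℕ (L x)) (path (suc m) q x)
        ≡⟨ allB-cong (λ u → ≤ᵇ-strictMono L-strictMono u x) (path (suc m) q x) ⟩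
      allB (λ u → toℕ u ≤ᵇ toℕ x) (path (suc m) q x)
        ≡⟨ cong (allB _) (sym (path-mono q x (m≤n⇒m≤1+n I≤m) (forest-q x))) ⟩
      allB (λ u → toℕ u ≤ᵇ toℕ x) (path I q x) ∎
      where
      open ≡-Reasoning
      L-strictMono : ∀ u x → toℕ u < toℕ x → toℕ (L u) < toℕ (L x)
      L-strictMono u x u<x rewrite toℕ-inject₁ (merge s (inj₁ u)) | toℕ-inject₁ (merge s (inj₁ x)) =
        merge₁-strictMono s u x u<x

    isRecord-R : ∀ y → isRecord P (R y) ≡ false
    isRecord-R y = allB-≤ᵇ-below-max (R y) (subst (_< m) (sym (toℕ-inject₁ _)) (toℕ<n _))
                                     (path (suc m) P (R y)) (inMaxSubtree-R forest-g y)

    isRootB-L : ∀ x → isRootB P (L x) ≡ isRootB q x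
    isRootB-L x = trans (isRootB≡is-nothing P (L x))
      (trans (cong is-nothing (glue-L q g a x)) (trans (is-nothing-map L (q x)) (sym (isRootB≡is-nothing q x))))

    isRootB-R : ∀ y → isRootB P (R y) ≡ false
    isRootB-R y = trans (isRootB≡is-nothing P (R y)) (trans (cong is-nothing (glue-R q g a y)) (attached (g y)))
      where
      attached : ∀ z → is-nothing (attachR z) ≡ false
      attached nothing  = refl
      attached (just _) = refl

    isRootB-max : isRootB P max ≡ is-nothing a
    isRootB-max = trans (isRootB≡is-nothing P max) (trans (cong is-nothing (glue-max q g a)) (is-nothing-map L a))

    records-glue : records P ≡ suc (records q)
    records-glue = begin
      records P
        ≡⟨ countB-positions (isRecord P) ⟩
      (∑Fin I (⟦_⟧ ∘ isRecord P ∘ L) + ∑Fin J (⟦_⟧ ∘ isRecord P ∘ R)) + ⟦ isRecord P max ⟧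
        ≡⟨ cong₂ _+_ (cong₂ _+_ (∑Fin-cong I (cong ⟦_⟧ ∘ isRecord-L))
                                (trans (∑Fin-cong J (cong ⟦_⟧ ∘ isRecord-R)) (∑Fin-zero J)))
                     (cong ⟦_⟧ (isRecord-max P)) ⟩
      (∑Fin I (⟦_⟧ ∘ isRecord q) + 0) + 1
        ≡⟨ trans (cong (_+ 1) (+-identityʳ _)) (+-comm _ 1) ⟩
      suc (∑Fin I (⟦_⟧ ∘ isRecord q))
        ≡⟨ cong suc (sym (countB-allFin I (isRecord q))) ⟩
      suc (records q) ∎
      where open ≡-Reasoning

    roots-glue : roots P ≡ roots q + ⟦ is-nothing a ⟧
    roots-glue = begin
      roots P
        ≡⟨ countB-positions (isRootB P) ⟩
      (∑Fin I (⟦_⟧ ∘ isRootB P ∘ L) + ∑Fin J (⟦_⟧ ∘ isRootB P ∘ R)) + ⟦ isRootB P max ⟧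
        ≡⟨ cong₂ _+_ (cong₂ _+_ (∑Fin-cong I (cong ⟦_⟧ ∘ isRootB-L))
                                (trans (∑Fin-cong J (cong ⟦_⟧ ∘ isRootB-R)) (∑Fin-zero J)))
                     (cong ⟦_⟧ isRootB-max) ⟩
      (∑Fin I (⟦_⟧ ∘ isRootB q) + 0) + ⟦ is-nothing a ⟧
        ≡⟨ cong (_+ ⟦ is-nothing a ⟧) (trans (+-identityʳ _) (sym (countB-allFin I (isRootB q)))) ⟩
      roots q + ⟦ is-nothing a ⟧ ∎
      where open ≡-Reasoning


tabulate-lookup : ∀ {f : Fin n → A} (w : Vec A n) → f ≗ lookup w → tabulate f ≡ w
tabulate-lookup w f≗w = trans (tabulate-cong f≗w) (tabulate∘lookup w)

-- Vectors rather than functions, so that pointwise equal parent maps give equal forests.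
Forest : ℕ → Set
Forest n = Σ (Vec (Maybe (Fin n)) n) (T ∘ isForest ∘ lookup)

parentMap : Forest n → ParentMap n
parentMap = lookup ∘ proj₁

Forest-IsForest : (F : Forest n) → IsForest (parentMap F)
Forest-IsForest (_ , forest) = isForest⇒IsForest (Equivalence.to T-≡ forest)

toForest : (p : ParentMap n) → IsForest p → Forest n
toForest p forest =
  tabulate p , Equivalence.from T-≡ (trans (isForest-cong (lookup∘tabulate p)) (IsForest⇒isForest forest))

-- The forest outside the subtree of the maximum, the parent of the maximum, and the forest below it.
Pieces : Vec Bool m → Set
Pieces s = (Forest (trues s) × Maybe (Fin (trues s))) × Forest (falses s)

outsideMaxSubtree-cong : {p p′ : ParentMap (suc m)} → p ≗ p′ → outsideMaxSubtree p ≡ outsideMaxSubtree p′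
outsideMaxSubtree-cong {m} p≗p′ = tabulate-cong (cong not ∘ cong (any isMax) ∘ path-cong p≗p′ (suc m) ∘ inject₁)

module Assembly {m} (s : Vec Bool m) where

  open Decomposition s

  restrictL-cong : {p p′ : ParentMap (suc m)} → p ≗ p′ → restrictL p ≗ restrictL p′
  restrictL-cong p≗p′ x = cong (_>>= indexL) (p≗p′ (L x))

  restrictR-cong : {p p′ : ParentMap (suc m)} → p ≗ p′ → restrictR p ≗ restrictR p′
  restrictR-cong p≗p′ y = cong (_>>= indexR) (p≗p′ (R y))

  parentOfMax-cong : {p p′ : ParentMap (suc m)} → p ≗ p′ → parentOfMax p ≡ parentOfMax p′
  parentOfMax-cong p≗p′ = cong (_>>= indexL) (p≗p′ max)

  glue-cong : ∀ {q q′ g g′} a → q ≗ q′ → g ≗ g′ → glue q g a ≗ glue q′ g′ a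
  glue-cong a q≗q′ g≗g′ v with dropMax v
  ... | nothing = refl
  ... | just w  with split s w
  ...   | inj₁ x = cong (Maybe.map L) (q≗q′ x)
  ...   | inj₂ y = cong attachR (g≗g′ y)

  pieces : (p : ParentMap (suc m)) → IsForest p → outsideMaxSubtree p ≡ s → Pieces s
  pieces p forest outside≡s =
    (toForest (restrictL p) restrictL-IsForest , parentOfMax p) , toForest (restrictR p) restrictR-IsForest
    where open Restrict p forest outside≡s

  assemble : Pieces s → Forest (suc m)
  assemble ((Q , a) , G) = toForest (glue (parentMap Q) (parentMap G) a) glue-IsForest
    where open GlueForests (parentMap Q) (parentMap G) a (Forest-IsForest Q) (Forest-IsForest G)

  outsideMaxSubtree-assemble : ∀ x → outsideMaxSubtree (parentMap (assemble x)) ≡ s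
  outsideMaxSubtree-assemble ((Q , a) , G) =
    trans (outsideMaxSubtree-cong (lookup∘tabulate P)) (outsideMaxSubtree-glue (Forest-IsForest G))
    where open Glue (parentMap Q) (parentMap G) a

  pieces-assemble : ∀ x (e : outsideMaxSubtree (parentMap (assemble x)) ≡ s) →
    pieces (parentMap (assemble x)) (Forest-IsForest (assemble x)) e ≡ x
  pieces-assemble ((Q , a) , G) e = cong₂ _,_
    (cong₂ _,_ (Σ-T-≡ (tabulate-lookup (proj₁ Q) (λ x → trans (restrictL-cong p≗P x) (restrictL-glue x))))
               (trans (parentOfMax-cong p≗P) parentOfMax-glue))
    (Σ-T-≡ (tabulate-lookup (proj₁ G) (λ y → trans (restrictR-cong p≗P y) (restrictR-glue y))))
    where
    open Glue (parentMap Q) (parentMap G) a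
    p≗P : parentMap (assemble ((Q , a) , G)) ≗ P
    p≗P = lookup∘tabulate P

  assemble-pieces : ∀ (F : Forest (suc m)) (e : outsideMaxSubtree (parentMap F) ≡ s) →
    assemble (pieces (parentMap F) (Forest-IsForest F) e) ≡ F
  assemble-pieces F e = Σ-T-≡ (tabulate-lookup (proj₁ F) (λ v →
    trans (glue-cong (parentOfMax p) (lookup∘tabulate _) (lookup∘tabulate _) v) (glue-restrict v)))
    where
    p = parentMap F
    open Restrict p (Forest-IsForest F) e

decompose : Forest (suc m) → Σ (Vec Bool m) Pieces
decompose F = outsideMaxSubtree (parentMap F) , Assembly.pieces _ (parentMap F) (Forest-IsForest F) refl

decompose-unique : ∀ (F : Forest (suc m)) {s s′} →
  (e : outsideMaxSubtree (parentMap F) ≡ s) (e′ : outsideMaxSubtree (parentMap F) ≡ s′) →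
  _≡_ {A = Σ (Vec Bool m) Pieces} (s , Assembly.pieces s (parentMap F) (Forest-IsForest F) e)
                                  (s′ , Assembly.pieces s′ (parentMap F) (Forest-IsForest F) e′)
decompose-unique F refl refl = refl

Forest-suc-↔ : Forest (suc m) ↔ Σ (Vec Bool m) Pieces
Forest-suc-↔ = mk↔ₛ′ decompose (λ (s , x) → Assembly.assemble s x)
  (λ (s , x) → let e = Assembly.outsideMaxSubtree-assemble s x in
     trans (decompose-unique (Assembly.assemble s x) refl e) (cong (s ,_) (Assembly.pieces-assemble s x e)))
  (λ F → Assembly.assemble-pieces _ F refl)


-- The recurrences on the maximal vertex

#Forests : ℕ → ℕ
#Forests n = countB isForest (allMaps n n)

↔Fin-Forest : ∀ n → Forest n ↔ Fin (#Forests n)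
↔Fin-Forest n = ↔Fin-allMaps n n isForest isForest-cong

↔Fin-Forest-with : ∀ n (P : ParentMap n → Bool) → Respects≗ P →
  Σ (Forest n) (T ∘ P ∘ parentMap) ↔ Fin (countB (λ p → isForest p ∧ P p) (allMaps n n))
↔Fin-Forest-with n P resp =
  ↔-trans (↔-sym Σ-T-∧) (↔Fin-allMaps n n _ (λ p≗q → cong₂ _∧_ (isForest-cong p≗q) (resp p≗q)))

↔Fin-Rforest : ∀ n k → Σ (Forest n) (T ∘ hasRecords k ∘ parentMap) ↔ Fin (Rforest n k)
↔Fin-Rforest n k = ↔Fin-Forest-with n (hasRecords k) (hasRecords-cong k)

isTreeWith : ℕ → ParentMap n → Bool
isTreeWith k p = (roots p ≡ᵇ 1) ∧ hasRecords k p

↔Fin-Rtree : ∀ n k → Σ (Forest n) (T ∘ isTreeWith k ∘ parentMap) ↔ Fin (Rtree n k)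
↔Fin-Rtree n k = ↔Fin-subst (countB-cong (λ p → sym (∧-assoc (isForest p) _ _)) (allMaps n n))
  (↔Fin-Forest-with n (isTreeWith k) (λ p≗q → cong₂ _∧_ (cong (_≡ᵇ 1) (roots-cong p≗q)) (hasRecords-cong k p≗q)))

module _ {m} (s : Vec Bool m) (Q : Forest (trues s)) (a : Maybe (Fin (trues s))) (G : Forest (falses s)) where

  open Decomposition s
  open Glue (parentMap Q) (parentMap G) a using (P)
  open GlueForests (parentMap Q) (parentMap G) a (Forest-IsForest Q) (Forest-IsForest G)

  records-assemble : records (parentMap (Assembly.assemble s ((Q , a) , G))) ≡ suc (records (parentMap Q))
  records-assemble = trans (records-cong (lookup∘tabulate P)) records-glue

  roots-assemble : roots (parentMap (Assembly.assemble s ((Q , a) , G))) ≡ roots (parentMap Q) + ⟦ is-nothing a ⟧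
  roots-assemble = trans (roots-cong (lookup∘tabulate P)) roots-glue

forest-recurrence : ∀ m k →
  Rforest (suc m) (suc k) ≡ ∑Bools m (λ s → (Rforest (trues s) k * suc (trues s)) * #Forests (falses s))
forest-recurrence m k = ↔Fin-unique (↔Fin-Rforest (suc m) (suc k))
  (↔-trans (Σ-T-transport Forest-suc-↔ {Q = λ (_ , ((Q , _) , _)) → hasRecords k (parentMap Q)}
             (λ (s , ((Q , a) , G)) → cong (_≡ᵇ suc k) (records-assemble s Q a G)))
  (↔-trans Σ-assoc
  (↔Fin-ΣBools m _ λ s →
    ↔-trans Σ-T-×ˡ (↔Fin-× (↔-trans Σ-T-×ˡ (↔Fin-× (↔Fin-Rforest (trues s) k) (↔Fin-Maybe ↔-refl)))
                           (↔Fin-Forest (falses s))))))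

-- A forest q with k + 1 records is nonempty, so it has a root; hence gluing gives a tree iff q is a tree and a ≠ nothing.
tree-condition : ∀ (q : ParentMap n) → IsForest q → ∀ k (a : Maybe (Fin n)) →
  (((roots q + ⟦ is-nothing a ⟧) ≡ᵇ 1) ∧ hasRecords (suc k) q) ≡ (isTreeWith (suc k) q ∧ is-just a)
tree-condition q forest k (just _) rewrite +-identityʳ (roots q) = sym (∧-identityʳ _)
tree-condition {zero}  q forest k nothing = refl
tree-condition {suc n} q forest k nothing with roots q | roots-pos {p = q} forest
... | suc r | _ rewrite +-comm r 1 = sym (∧-zeroʳ _)

↔Fin-is-just : Σ (Maybe (Fin n)) (T ∘ is-just) ↔ Fin n
↔Fin-is-just = mk↔ₛ′ (λ { (just x , _) → x ; (nothing , ()) }) (λ x → just x , _)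
  (λ _ → refl) (λ { (just _ , _) → refl ; (nothing , ()) })

tree-recurrence : ∀ m k →
  Rtree (suc m) (suc (suc k)) ≡ ∑Bools m (λ s → (Rtree (trues s) (suc k) * trues s) * #Forests (falses s))
tree-recurrence m k = ↔Fin-unique (↔Fin-Rtree (suc m) (suc (suc k)))
  (↔-trans (Σ-T-transport Forest-suc-↔
              {Q = λ (_ , ((Q , a) , _)) → ((roots (parentMap Q) + ⟦ is-nothing a ⟧) ≡ᵇ 1) ∧ hasRecords (suc k) (parentMap Q)}
              (λ (s , ((Q , a) , G)) → cong₂ _∧_ (cong (_≡ᵇ 1) (roots-assemble s Q a G))
                                                 (cong (_≡ᵇ suc (suc k)) (records-assemble s Q a G))))
  (↔-trans Σ-assoc
  (↔Fin-ΣBools m _ λ s →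
    ↔-trans Σ-T-×ˡ (↔Fin-× (↔-trans (Σ-T-cong (λ (Q , a) → tree-condition (parentMap Q) (Forest-IsForest Q) k a))
                           (↔-trans Σ-T-× (↔Fin-× (↔Fin-Rtree (trues s) (suc k)) ↔Fin-is-just)))
                           (↔Fin-Forest (falses s))))))

records-range : ∀ (p : ParentMap n) → (n ≡ 0 × records p ≡ 0) ⊎ (1 ≤ n × 1 ≤ records p × records p ≤ n)
records-range {zero}  p = inj₁ (refl , refl)
records-range {suc n} p = inj₂ (s≤s z≤n , records-pos p , records-≤ p)

Rforest-Rtree-vanish : ∀ n k → (∀ (p : ParentMap n) → records p ≢ k) → Rforest n k ≡ 0 × Rtree n k ≡ 0
Rforest-Rtree-vanish n k records≢k =
  countB-false (λ p → trans (cong (isForest p ∧_) (≢⇒≡ᵇ-false (records≢k p))) (∧-zeroʳ _)) (allMaps n n) ,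
  countB-false (λ p → trans (cong (isTree p ∧_) (≢⇒≡ᵇ-false (records≢k p))) (∧-zeroʳ _)) (allMaps n n)

-- A forest has at least one root, and every root is a record.
single-record-tree : ∀ (p : ParentMap (suc n)) → (isTree p ∧ hasRecords 1 p) ≡ (isForest p ∧ hasRecords 1 p)
single-record-tree p with isForest p in forest | records p ≡ᵇ 1 in one-record
... | false | _     = refl
... | true  | false = ∧-zeroʳ _
... | true  | true  = cong (λ r → (r ≡ᵇ 1) ∧ true) (≤-antisym
      (subst (roots p ≤_) (≡ᵇ-true⇒≡ one-record) (roots≤records p))
      (roots-pos {p = p} (isForest⇒IsForest {p = p} forest)))

Rtree≡Rforest-one-record : ∀ m → Rtree (suc m) 1 ≡ Rforest (suc m) 1
Rtree≡Rforest-one-record m = countB-cong single-record-tree (allMaps (suc m) (suc m))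


-- Binomial sums

∑< : ℕ → (ℕ → ℕ) → ℕ
∑< zero    f = 0
∑< (suc n) f = f 0 + ∑< n (f ∘ suc)

∑<-cong : ∀ n {f g : ℕ → ℕ} → (∀ i → i < n → f i ≡ g i) → ∑< n f ≡ ∑< n g
∑<-cong zero    f≡g = refl
∑<-cong (suc n) f≡g = cong₂ _+_ (f≡g 0 (s≤s z≤n)) (∑<-cong n (λ i i<n → f≡g (suc i) (s≤s i<n)))

∑<-zero : ∀ n (f : ℕ → ℕ) → (∀ i → i < n → f i ≡ 0) → ∑< n f ≡ 0
∑<-zero n f f≡0 = trans (∑<-cong n f≡0) (zeros n)
  where
  zeros : ∀ n → ∑< n (λ _ → 0) ≡ 0
  zeros zero    = refl
  zeros (suc n) = zeros n

∑<-+ : ∀ n (f g : ℕ → ℕ) → ∑< n (λ i → f i + g i) ≡ ∑< n f + ∑< n g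
∑<-+ zero    f g = refl
∑<-+ (suc n) f g = trans (cong (f 0 + g 0 +_) (∑<-+ n (f ∘ suc) (g ∘ suc))) (interchange (f 0) (g 0) _ _)

∑<-*ˡ : ∀ n a (f : ℕ → ℕ) → ∑< n (λ i → a * f i) ≡ a * ∑< n f
∑<-*ˡ zero    a f = sym (*-zeroʳ a)
∑<-*ˡ (suc n) a f = trans (cong (a * f 0 +_) (∑<-*ˡ n a (f ∘ suc))) (sym (*-distribˡ-+ a (f 0) _))

∑<-last : ∀ n (f : ℕ → ℕ) → ∑< (suc n) f ≡ ∑< n f + f n
∑<-last zero    f = +-comm (f 0) 0
∑<-last (suc n) f = trans (cong (f 0 +_) (∑<-last n (f ∘ suc))) (sym (+-assoc (f 0) _ _))

∑<-split : ∀ a r (f : ℕ → ℕ) → ∑< (a + r) f ≡ ∑< a f + ∑< r (λ j → f (a + j))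
∑<-split zero    r f = refl
∑<-split (suc a) r f = trans (cong (f 0 +_) (∑<-split a r (f ∘ suc))) (sym (+-assoc (f 0) _ _))

sumFromTo≡∑< : ∀ a b (f : ℕ → ℕ) → a ≤ suc b → (∀ i → i < a → f i ≡ 0) → sumFromTo a b f ≡ ∑< (suc b) f
sumFromTo≡∑< a b f a≤1+b f≡0 = begin
  sum (map (λ j → f (a + j)) (applyUpTo (λ i → i) (suc b ∸ a)))
    ≡⟨ sum-applyUpTo (suc b ∸ a) (λ i → i) ⟩
  ∑< (suc b ∸ a) (λ j → f (a + j))
    ≡⟨ cong (_+ ∑< (suc b ∸ a) (λ j → f (a + j))) (sym (∑<-zero a f f≡0)) ⟩
  ∑< a f + ∑< (suc b ∸ a) (λ j → f (a + j))
    ≡⟨ sym (∑<-split a (suc b ∸ a) f) ⟩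
  ∑< (a + (suc b ∸ a)) f
    ≡⟨ cong (λ n → ∑< n f) (m+[n∸m]≡n a≤1+b) ⟩
  ∑< (suc b) f ∎
  where
  open ≡-Reasoning
  sum-applyUpTo : ∀ n (g : ℕ → ℕ) {h : ℕ → ℕ} → sum (map h (applyUpTo g n)) ≡ ∑< n (h ∘ g)
  sum-applyUpTo zero    g     = refl
  sum-applyUpTo (suc n) g {h} = cong (h (g 0) +_) (sum-applyUpTo n (g ∘ suc))

∑Bools-*ˡ : ∀ m a (c : Vec Bool m → ℕ) → ∑Bools m (λ s → a * c s) ≡ a * ∑Bools m c
∑Bools-*ˡ zero    a c = refl
∑Bools-*ˡ (suc m) a c =
  trans (cong₂ _+_ (∑Bools-*ˡ m a (c ∘ (true ∷_))) (∑Bools-*ˡ m a (c ∘ (false ∷_)))) (sym (*-distribˡ-+ a _ _))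

∑Bools-trues : ∀ m (h : ℕ → ℕ) → ∑Bools m (h ∘ trues) ≡ ∑< (suc m) (λ i → (m C i) * h i)
∑Bools-trues zero    h = sym (trans (+-identityʳ _) (+-identityʳ _))
∑Bools-trues (suc m) h = begin
  ∑Bools m (h ∘ suc ∘ trues) + ∑Bools m (h ∘ trues)
    ≡⟨ cong₂ _+_ (∑Bools-trues m (h ∘ suc)) (∑Bools-trues m h) ⟩
  ∑< (suc m) α + (1 * h 0 + ∑< m β)
    ≡⟨ solve 3 (λ a h b → a :+ (con 1 :* h :+ b) := con 1 :* h :+ (a :+ (b :+ con 0))) refl
               (∑< (suc m) α) (h 0) (∑< m β) ⟩
  1 * h 0 + (∑< (suc m) α + (∑< m β + 0))
    ≡⟨ cong (λ x → 1 * h 0 + (∑< (suc m) α + (∑< m β + x))) (sym (cong (_* h (suc m)) (k>n⇒nCk≡0 (n<1+n m)))) ⟩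
  1 * h 0 + (∑< (suc m) α + (∑< m β + β m))
    ≡⟨ cong (λ x → 1 * h 0 + (∑< (suc m) α + x)) (sym (∑<-last m β)) ⟩
  1 * h 0 + (∑< (suc m) α + ∑< (suc m) β)
    ≡⟨ cong (1 * h 0 +_) (sym (∑<-+ (suc m) α β)) ⟩
  1 * h 0 + ∑< (suc m) (λ i → α i + β i)
    ≡⟨ cong (1 * h 0 +_) (∑<-cong (suc m) (λ i _ → pascal i)) ⟩
  ∑< (suc (suc m)) (λ i → (suc m C i) * h i) ∎
  where
  open ≡-Reasoning
  α β : ℕ → ℕ
  α i = (m C i) * h (suc i)
  β i = (m C suc i) * h (suc i)
  pascal : ∀ i → α i + β i ≡ (suc m C suc i) * h (suc i)
  pascal i = trans (sym (*-distribʳ-+ (h (suc i)) (m C i) (m C suc i)))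
                   (cong (_* h (suc i)) (nCk+nC[k+1]≡[n+1]C[k+1] m i))

falses≡ : ∀ {m} (s : Vec Bool m) → falses s ≡ m ∸ trues s
falses≡ {m} s = trans (sym (m+n∸m≡n (trues s) (falses s))) (cong (_∸ trues s) (trues+falses s))

∑Bools-trues-falses : ∀ m (h : ℕ → ℕ → ℕ) →
  ∑Bools m (λ s → h (trues s) (falses s)) ≡ ∑< (suc m) (λ i → (m C i) * h i (m ∸ i))
∑Bools-trues-falses m h = trans (∑Bools-cong m (λ s → cong (h (trues s)) (falses≡ s))) (∑Bools-trues m (λ i → h i (m ∸ i)))

binomial-subsets : ∀ M a b → (a + b) ^ M ≡ ∑Bools M (λ s → a ^ trues s * b ^ falses s)
binomial-subsets zero    a b = refl
binomial-subsets (suc M) a b = begin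
  (a + b) * (a + b) ^ M
    ≡⟨ cong ((a + b) *_) (binomial-subsets M a b) ⟩
  (a + b) * ∑Bools M (λ s → a ^ trues s * b ^ falses s)
    ≡⟨ *-distribʳ-+ _ a b ⟩
  a * ∑Bools M (λ s → a ^ trues s * b ^ falses s) + b * ∑Bools M (λ s → a ^ trues s * b ^ falses s)
    ≡⟨ sym (cong₂ _+_ (∑Bools-*ˡ M a _) (∑Bools-*ˡ M b _)) ⟩
  ∑Bools M (λ s → a * (a ^ trues s * b ^ falses s)) + ∑Bools M (λ s → b * (a ^ trues s * b ^ falses s))
    ≡⟨ cong₂ _+_ (∑Bools-cong M (λ s → sym (*-assoc a (a ^ trues s) (b ^ falses s))))
                 (∑Bools-cong M (λ s → x*[y*z]≡y*[x*z] b (a ^ trues s) (b ^ falses s))) ⟩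
  ∑Bools M (λ s → a ^ suc (trues s) * b ^ falses s) + ∑Bools M (λ s → a ^ trues s * b ^ suc (falses s)) ∎
  where
  open ≡-Reasoning
  x*[y*z]≡y*[x*z] : ∀ x y z → x * (y * z) ≡ y * (x * z)
  x*[y*z]≡y*[x*z] = solve 3 (λ x y z → x :* (y :* z) := y :* (x :* z)) refl

binomial-theorem : ∀ M a b → (a + b) ^ M ≡ ∑< (suc M) (λ j → (M C j) * (a ^ j * b ^ (M ∸ j)))
binomial-theorem M a b = trans (binomial-subsets M a b) (∑Bools-trues-falses M (λ i j → a ^ i * b ^ j))

absorption : ∀ M j → suc j * (suc M C suc j) ≡ suc M * (M C j)
absorption zero    zero    = refl
absorption zero    (suc j)
  rewrite k>n⇒nCk≡0 {1} {suc (suc j)} (s≤s (s≤s z≤n)) | k>n⇒nCk≡0 {0} {suc j} (s≤s z≤n) = *-zeroʳ (suc (suc j))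
absorption (suc M) zero    rewrite nC1≡n (suc (suc M)) = *-comm 1 (suc (suc M))
absorption (suc M) (suc j) = begin
  suc (suc j) * (suc (suc M) C suc (suc j))
    ≡⟨ cong (suc (suc j) *_) (sym (nCk+nC[k+1]≡[n+1]C[k+1] (suc M) (suc j))) ⟩
  suc (suc j) * (α + β)
    ≡⟨ solve 3 (λ j α β → (con 1 :+ j) :* (α :+ β) := (j :* α :+ α) :+ (con 1 :+ j) :* β) refl (suc j) α β ⟩
  (suc j * α + α) + suc (suc j) * β
    ≡⟨ cong₂ (λ u v → (u + α) + v) (absorption M j) (absorption M (suc j)) ⟩
  (suc M * (M C j) + α) + suc M * (M C suc j)
    ≡⟨ solve 4 (λ m x y α → (m :* x :+ α) :+ m :* y := m :* (x :+ y) :+ α) refl (suc M) (M C j) (M C suc j) α ⟩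
  suc M * ((M C j) + (M C suc j)) + α
    ≡⟨ cong (λ z → suc M * z + α) (nCk+nC[k+1]≡[n+1]C[k+1] M j) ⟩
  suc M * α + α
    ≡⟨ +-comm (suc M * α) α ⟩
  suc (suc M) * α ∎
  where
  open ≡-Reasoning
  α = suc M C suc j
  β = suc M C suc (suc j)


-- Coloured forests and Cayley's formula

-- A vertex sent to inj₁ c is a root of colour c; one sent to inj₂ w has parent w.
uncolour : ∀ {k} → (Fin n → Fin k ⊎ Fin n) → ParentMap n
uncolour f = Sum.[ const nothing , just ] ∘ f

ColouredForest : ℕ → ℕ → Set
ColouredForest n k = Σ (Vec (Fin k ⊎ Fin n) n) (T ∘ isForest ∘ uncolour ∘ lookup)

colouredForests : ℕ → ℕ → ℕ
colouredForests zero    k = 1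
colouredForests (suc m) k = k * (k + suc m) ^ m

-- The colours of the roots marked by s, and the parents of the other vertices among roots and non-roots.
ColouredPieces : Vec Bool n → ℕ → Set
ColouredPieces s k = Vec (Fin k) (trues s) × Vec (Fin (trues s) ⊎ Fin (falses s)) (falses s)

module ColouredGlue (s : Vec Bool n) {k} (c : Vec (Fin k) (trues s)) (f : Fin (falses s) → Fin (trues s) ⊎ Fin (falses s)) where

  glue : Fin n → Fin k ⊎ Fin n
  glue v = Sum.[ inj₁ ∘ lookup c , inj₂ ∘ merge s ∘ f ] (split s v)

  glue-root : ∀ x → glue (merge s (inj₁ x)) ≡ inj₁ (lookup c x)
  glue-root x rewrite split-merge s (inj₁ x) = refl

  glue-child : ∀ y → glue (merge s (inj₂ y)) ≡ inj₂ (merge s (f y))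
  glue-child y rewrite split-merge s (inj₂ y) = refl

  P : ParentMap n
  P = uncolour glue

  P-root : ∀ x → P (merge s (inj₁ x)) ≡ nothing
  P-root x = cong Sum.[ const nothing , just ] (glue-root x)

  P-child : ∀ y → P (merge s (inj₂ y)) ≡ just (merge s (f y))
  P-child y = cong Sum.[ const nothing , just ] (glue-child y)

  reachesRoot-glue : ∀ K y → reachesRoot (suc K) P (merge s (inj₂ y)) ≡ reachesRoot K (uncolour f) y
  reachesRoot-glue zero    y = reachesRoot-parent P 0 (P-child y)
  reachesRoot-glue (suc K) y with f y in fy
  ... | inj₁ x  = trans (reachesRoot-parent P (suc K) (trans (P-child y) (cong (just ∘ merge s) fy))) (reachesRoot-root P K (P-root x))
  ... | inj₂ y′ = trans (reachesRoot-parent P (suc K) (trans (P-child y) (cong (just ∘ merge s) fy))) (reachesRoot-glue K y′)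

  isForest-glue : isForest P ≡ isForest (uncolour f)
  isForest-glue = ⇔→≡ (mk⇔ glue-forest⇒ glue-forest⇐)
    where
    glue-forest⇒ : isForest P ≡ true → isForest (uncolour f) ≡ true
    glue-forest⇒ forest = IsForest⇒isForest {p = uncolour f} λ y → reachesRoot-within (uncolour f) n y
      (trans (sym (reachesRoot-glue n y)) (reachesRoot-mono P _ (n≤1+n n) (isForest⇒IsForest {p = P} forest (merge s (inj₂ y)))))
    glue-forest⇐ : isForest (uncolour f) ≡ true → isForest P ≡ true
    glue-forest⇐ forest = IsForest⇒isForest {p = P} λ v → case side s v of λ where
      (onTrue x)  → reachesRoot-within P 1 _ (reachesRoot-root P 0 (P-root x))
      (onFalse y) → reachesRoot-within P (suc (falses s)) _
                      (trans (reachesRoot-glue (falses s) y) (isForest⇒IsForest {p = uncolour f} forest y))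

isInj₁ : A ⊎ B → Bool
isInj₁ = Sum.[ const true , const false ]

rootMarks : ∀ {k} → Vec (Fin k ⊎ Fin n) n → Vec Bool n
rootMarks g = tabulate (isInj₁ ∘ lookup g)

-- The defaults zero and inj₂ y are never used when s are the root marks of g.
colouredPieces : ∀ {k} (s : Vec Bool n) → Vec (Fin (suc k) ⊎ Fin n) n → ColouredPieces s (suc k)
colouredPieces s g = tabulate (λ x → Sum.fromInj₁ (const zero) (lookup g (merge s (inj₁ x))))
                   , tabulate (λ y → Sum.[ const (inj₂ y) , split s ] (lookup g (merge s (inj₂ y))))

assembleColoured : ∀ {k} → Σ (Vec Bool n) (λ s → ColouredPieces s k) → Vec (Fin k ⊎ Fin n) n
assembleColoured (s , c , f) = tabulate (ColouredGlue.glue s c (lookup f))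

module _ {k : ℕ} where

  pieces-assembleColoured : ∀ (x : Σ (Vec Bool n) (λ s → ColouredPieces s (suc k))) →
    let g = assembleColoured x in (rootMarks g , colouredPieces (rootMarks g) g) ≡ x
  pieces-assembleColoured {n} (s , c , f) = trans (same-marks (rootMarks g) marks≡s) (cong (s ,_) (cong₂ _,_ colours≡c parents≡f))
    where
    open ColouredGlue s c (lookup f)
    g = assembleColoured (s , c , f)
    same-marks : ∀ s′ → s′ ≡ s → _≡_ {A = Σ (Vec Bool n) (λ s → ColouredPieces s (suc k))}
                                     (s′ , colouredPieces s′ g) (s , colouredPieces s g)
    same-marks s′ refl = refl
    marks≡s : rootMarks g ≡ s
    marks≡s = tabulate-lookup s (λ v → trans (cong isInj₁ (lookup∘tabulate glue v)) (mark v))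
      where
      mark : ∀ v → isInj₁ (glue v) ≡ lookup s v
      mark v with side s v
      ... | onTrue x  = trans (cong isInj₁ (glue-root x)) (sym (lookup-merge₁ s x))
      ... | onFalse y = trans (cong isInj₁ (glue-child y)) (sym (lookup-merge₂ s y))
    colours≡c : proj₁ (colouredPieces s g) ≡ c
    colours≡c = tabulate-lookup c (λ x → cong (Sum.fromInj₁ (const zero)) (trans (lookup∘tabulate glue _) (glue-root x)))
    parents≡f : proj₂ (colouredPieces s g) ≡ f
    parents≡f = tabulate-lookup f (λ y →
      trans (cong Sum.[ const (inj₂ y) , split s ] (trans (lookup∘tabulate glue _) (glue-child y))) (split-merge s _))

  assembleColoured-pieces : ∀ (g : Vec (Fin (suc k) ⊎ Fin n) n) → assembleColoured (rootMarks g , colouredPieces (rootMarks g) g) ≡ g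
  assembleColoured-pieces g = tabulate-lookup g entry
    where
    s = rootMarks g
    open ColouredGlue s (proj₁ (colouredPieces s g)) (lookup (proj₂ (colouredPieces s g)))
    marks : ∀ v → lookup s v ≡ isInj₁ (lookup g v)
    marks = lookup∘tabulate _
    entry : ∀ v → glue v ≡ lookup g v
    entry v with side s v
    ... | onTrue x = trans (glue-root x)
        (trans (cong inj₁ (lookup∘tabulate _ x)) (root-entry (lookup g _) (trans (sym (marks _)) (lookup-merge₁ s x))))
      where
      root-entry : ∀ z → isInj₁ z ≡ true → inj₁ (Sum.fromInj₁ (const zero) z) ≡ z
      root-entry (inj₁ _) _ = refl
    ... | onFalse y = trans (glue-child y)
        (trans (cong (inj₂ ∘ merge s) (lookup∘tabulate _ y)) (child-entry (lookup g _) (trans (sym (marks _)) (lookup-merge₂ s y))))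
      where
      child-entry : ∀ z → isInj₁ z ≡ false → inj₂ (merge s (Sum.[ const (inj₂ y) , split s ] z)) ≡ z
      child-entry (inj₂ w) _ = cong inj₂ (merge-split s w)

  ColouredMap-↔ : Vec (Fin (suc k) ⊎ Fin n) n ↔ Σ (Vec Bool n) (λ s → ColouredPieces s (suc k))
  ColouredMap-↔ = mk↔ₛ′ (λ g → rootMarks g , colouredPieces (rootMarks g) g) assembleColoured
                        pieces-assembleColoured assembleColoured-pieces

-- An instance of Abel's identity: colouredForests satisfies the recurrence given by the decomposition at the roots.
colouredForests-recurrence : ∀ M k₀ →
  ∑< (suc (suc M)) (λ i → (suc M C i) * (suc k₀ ^ i * colouredForests (suc M ∸ i) i)) ≡ colouredForests (suc M) (suc k₀)
colouredForests-recurrence M k₀ = begin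
  ∑< (suc N) t          ≡⟨ ∑<-last N t ⟩
  ∑< N t + t N          ≡⟨ cong₂ _+_ (trans (∑<-cong M (λ j j<M → t-suc j j<M)) (∑<-*ˡ M k u)) t-N ⟩
  k * ∑< M u + k * u M  ≡⟨ sym (*-distribˡ-+ k (∑< M u) (u M)) ⟩
  k * (∑< M u + u M)    ≡⟨ cong (k *_) (sym (∑<-last M u)) ⟩
  k * ∑< (suc M) u      ≡⟨ cong (k *_) (sym (binomial-theorem M k N)) ⟩
  k * (k + N) ^ M       ∎
  where
  open ≡-Reasoning
  N = suc M
  k = suc k₀
  t u : ℕ → ℕ
  t i = (N C i) * (k ^ i * colouredForests (N ∸ i) i)
  u j = (M C j) * (k ^ j * N ^ (M ∸ j))
  ∸-suc : ∀ {M j} → j < M → M ∸ j ≡ suc (M ∸ suc j)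
  ∸-suc {suc M} {zero}  _         = refl
  ∸-suc {suc M} {suc j} (s≤s j<M) = ∸-suc j<M
  t-N : t N ≡ k * u M
  t-N = begin
    (N C N) * (k ^ N * colouredForests (N ∸ N) N)
      ≡⟨ cong₂ (λ c g → c * (k ^ N * g)) (nCn≡1 N) (cong (λ z → colouredForests z N) (n∸n≡0 N)) ⟩
    1 * (k * k ^ M * 1)
      ≡⟨ solve 2 (λ k x → con 1 :* ((k :* x) :* con 1) := k :* (con 1 :* (x :* con 1))) refl k (k ^ M) ⟩
    k * (1 * (k ^ M * 1))
      ≡⟨ sym (cong (k *_) (cong₂ (λ c g → c * (k ^ M * g)) (nCn≡1 M) (cong (N ^_) (n∸n≡0 M)))) ⟩
    k * u M ∎
  t-suc : ∀ j → j < M → t (suc j) ≡ k * u j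
  t-suc j j<M = begin
    α * (k ^ suc j * colouredForests (M ∸ j) (suc j))
      ≡⟨ cong (λ z → α * (k ^ suc j * colouredForests z (suc j))) (∸-suc j<M) ⟩
    α * ((k * k ^ j) * (suc j * (suc j + suc e) ^ e))
      ≡⟨ cong (λ z → α * ((k * k ^ j) * (suc j * z ^ e))) j+1+e≡N ⟩
    α * ((k * k ^ j) * (suc j * N ^ e))
      ≡⟨ solve 5 (λ α k kj sj ne → α :* ((k :* kj) :* (sj :* ne)) := (k :* kj :* ne) :* (sj :* α)) refl α k (k ^ j) (suc j) (N ^ e) ⟩
    (k * k ^ j * N ^ e) * (suc j * α)
      ≡⟨ cong ((k * k ^ j * N ^ e) *_) (absorption M j) ⟩
    (k * k ^ j * N ^ e) * (N * β)
      ≡⟨ solve 5 (λ β k kj n ne → (k :* kj :* ne) :* (n :* β) := k :* (β :* (kj :* (n :* ne)))) refl β k (k ^ j) N (N ^ e) ⟩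
    k * (β * (k ^ j * (N * N ^ e)))
      ≡⟨ cong (λ z → k * (β * (k ^ j * N ^ z))) (sym (∸-suc j<M)) ⟩
    k * u j ∎
    where
    e = M ∸ suc j
    α = N C suc j
    β = M C j
    j+1+e≡N : suc j + suc e ≡ N
    j+1+e≡N = trans (+-suc (suc j) e) (cong suc (m+[n∸m]≡n j<M))

-- A nonempty forest has a root, which needs a colour.
↔Fin-ColouredForest-uncoloured : ∀ m → ColouredForest (suc m) 0 ↔ Fin 0
↔Fin-ColouredForest-uncoloured m = mk↔ₛ′ (λ (g , forest) → ⊥-elim (no-root g forest)) (λ ()) (λ ())
                                         (λ (g , forest) → ⊥-elim (no-root g forest))
  where
  no-root : ∀ g → T (isForest (uncolour (lookup g))) → ⊥
  no-root g forest with root-exists (uncolour (lookup g)) (suc m) zero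
                          (isForest⇒IsForest {p = uncolour (lookup g)} (Equivalence.to T-≡ forest) zero)
  ... | r , root with lookup g r
  ... | inj₁ ()
  ... | inj₂ _ = case root of λ ()

↔Fin-ColouredForest : ∀ n k → ColouredForest n k ↔ Fin (colouredForests n k)
↔Fin-ColouredForest = <-rec _ step
  where
  step : ∀ n → (∀ {n′} → n′ < n → ∀ k → ColouredForest n′ k ↔ Fin (colouredForests n′ k)) →
         ∀ k → ColouredForest n k ↔ Fin (colouredForests n k)
  step zero    _   k        = mk↔ₛ′ (λ _ → zero) (λ _ → [] , _) (λ { zero → refl }) (λ { ([] , _) → refl })
  step (suc m) _   zero     = ↔Fin-ColouredForest-uncoloured m
  step (suc m) rec (suc k₀) = ↔Fin-subst count
    (↔-trans (Σ-T-transport ColouredMap-↔ {Q = λ (_ , _ , f) → isForest (uncolour (lookup f))} isForest-assemble)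
    (↔-trans Σ-assoc
    (↔Fin-ΣBools (suc m) _ λ s →
      ↔-trans Σ-T-×ʳ (↔Fin-× (↔Fin-Vec (trues s) ↔-refl) (smaller (trues s) (falses s) (trues+falses s))))))
    where
    isForest-assemble : ∀ ((s , c , f) : Σ (Vec Bool (suc m)) (λ s → ColouredPieces s (suc k₀))) →
      isForest (uncolour (lookup (assembleColoured (s , c , f)))) ≡ isForest (uncolour (lookup f))
    isForest-assemble (s , c , f) =
      trans (isForest-cong (cong Sum.[ const nothing , just ] ∘ lookup∘tabulate glue)) isForest-glue
      where open ColouredGlue s c (lookup f)
    smaller : ∀ i j → i + j ≡ suc m → ColouredForest j i ↔ Fin (colouredForests j i)
    smaller zero    j refl  = ↔Fin-ColouredForest-uncoloured m
    smaller (suc i) j i+j≡n = rec (subst (j <_) i+j≡n (s≤s (m≤n+m j i))) (suc i)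
    count : ∑Bools (suc m) (λ s → suc k₀ ^ trues s * colouredForests (falses s) (trues s)) ≡ colouredForests (suc m) (suc k₀)
    count = trans (∑Bools-trues-falses (suc m) (λ i j → suc k₀ ^ i * colouredForests j i)) (colouredForests-recurrence m k₀)

Maybe-↔ : Maybe (Fin n) ↔ (Fin 1 ⊎ Fin n)
Maybe-↔ = mk↔ₛ′ (λ { nothing → inj₁ zero ; (just w) → inj₂ w }) Sum.[ const nothing , just ]
  (λ { (inj₁ zero) → refl ; (inj₂ _) → refl }) (λ { nothing → refl ; (just _) → refl })

#Forests≡colouredForests : ∀ n → #Forests n ≡ colouredForests n 1
#Forests≡colouredForests n = ↔Fin-unique (↔Fin-Forest n)
  (↔-trans (Σ-T-transport (Vec-↔ Maybe-↔) (λ v → isForest-cong (λ i → lookup-map i _ v))) (↔Fin-ColouredForest n 1))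

cayley : ∀ n → #Forests n ≡ suc n ^ (n ∸ 1)
cayley zero    = #Forests≡colouredForests zero
cayley (suc m) = trans (#Forests≡colouredForests (suc m)) (+-identityʳ _)

recurrence-term : ∀ m i r w → i ≤ m →
  (m C i) * ((r * w) * #Forests (m ∸ i)) ≡ (m C i) * r * (suc m ∸ i) ^ (suc m ∸ i ∸ 2) * w
recurrence-term m i r w i≤m = begin
  (m C i) * ((r * w) * #Forests (m ∸ i))
    ≡⟨ cong (λ f → (m C i) * ((r * w) * f)) (cayley (m ∸ i)) ⟩
  (m C i) * ((r * w) * suc (m ∸ i) ^ (suc (m ∸ i) ∸ 2))
    ≡⟨ solve 4 (λ c r w f → c :* ((r :* w) :* f) := ((c :* r) :* f) :* w) refl (m C i) r w _ ⟩
  (m C i) * r * suc (m ∸ i) ^ (suc (m ∸ i) ∸ 2) * w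
    ≡⟨ cong (λ n → (m C i) * r * n ^ (n ∸ 2) * w) (sym (+-∸-assoc 1 i≤m)) ⟩
  (m C i) * r * (suc m ∸ i) ^ (suc m ∸ i ∸ 2) * w ∎
  where open ≡-Reasoning

∑Bools-as-sumFromTo : ∀ m a (r w : ℕ → ℕ) → a ≤ suc m → (∀ i → i < a → r i ≡ 0) →
  ∑Bools m (λ s → (r (trues s) * w (trues s)) * #Forests (falses s)) ≡
  sumFromTo a m (λ i → (m C i) * r i * (suc m ∸ i) ^ (suc m ∸ i ∸ 2) * w i)
∑Bools-as-sumFromTo m a r w a≤1+m r≡0 =
  trans (∑Bools-trues-falses m (λ i j → (r i * w i) * #Forests j))
  (trans (∑<-cong (suc m) (λ i i≤m → recurrence-term m i (r i) (w i) (≤-pred i≤m)))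
         (sym (sumFromTo≡∑< a m _ a≤1+m (λ i i<a → vanishing-term i (r≡0 i i<a)))))
  where
  vanishing-term : ∀ i → r i ≡ 0 → (m C i) * r i * (suc m ∸ i) ^ (suc m ∸ i ∸ 2) * w i ≡ 0
  vanishing-term i ri≡0 rewrite ri≡0 | *-zeroʳ (m C i) = refl

records-too-many : ∀ {n k} → n < k → ∀ (p : ParentMap n) → records p ≢ k
records-too-many {n} n<k p records≡k = <⇒≱ n<k (subst (_≤ n) records≡k (records-≤ p))

records-out-of-range : ∀ n k → ¬ (n ≡ 0 × k ≡ 0) → ¬ (1 ≤ n × 1 ≤ k × k ≤ n) →
  ∀ (p : ParentMap n) → records p ≢ k
records-out-of-range n k not-empty not-in-range p refl = [ not-empty , not-in-range ] (records-range p)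

Rtree-recurrence : (n k : ℕ) → 1 ≤ n → 2 ≤ k → k ≤ n →
  Rtree n k ≡ sumFromTo (k ∸ 1) (n ∸ 1)
    (λ i → ((n ∸ 1) C i) * Rtree i (k ∸ 1) * (n ∸ i) ^ (n ∸ i ∸ 2) * i)
Rtree-recurrence (suc m) (suc zero)    _ (s≤s ()) _
Rtree-recurrence (suc m) (suc (suc k)) _ _ (s≤s k<m) =
  trans (tree-recurrence m k)
        (∑Bools-as-sumFromTo m (suc k) (λ i → Rtree i (suc k)) (λ i → i) (m≤n⇒m≤1+n k<m)
          (λ i i<k → proj₂ (Rforest-Rtree-vanish i (suc k) (records-too-many i<k))))

Rtree-one-record : (n : ℕ) → 1 ≤ n → Rtree n 1 ≡ n ^ (n ∸ 2)
Rtree-one-record (suc m) _ = begin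
  Rtree (suc m) 1
    ≡⟨ Rtree≡Rforest-one-record m ⟩
  Rforest (suc m) 1
    ≡⟨ forest-recurrence m 0 ⟩
  ∑Bools m (λ s → (Rforest (trues s) 0 * suc (trues s)) * #Forests (falses s))
    ≡⟨ ∑Bools-trues-falses m (λ i j → (Rforest i 0 * suc i) * #Forests j) ⟩
  1 * ((1 * 1) * #Forests m) + ∑< m nonempty-term
    ≡⟨ cong (1 * ((1 * 1) * #Forests m) +_) (∑<-zero m nonempty-term (λ i _ → nonempty-term≡0 i)) ⟩
  1 * ((1 * 1) * #Forests m) + 0
    ≡⟨ solve 1 (λ f → con 1 :* ((con 1 :* con 1) :* f) :+ con 0 := f) refl (#Forests m) ⟩
  #Forests m
    ≡⟨ cayley m ⟩
  suc m ^ (m ∸ 1) ∎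
  where
  open ≡-Reasoning
  nonempty-term : ℕ → ℕ
  nonempty-term i = (m C suc i) * ((Rforest (suc i) 0 * suc (suc i)) * #Forests (m ∸ suc i))
  no-records : ∀ i → Rforest (suc i) 0 ≡ 0
  no-records i = proj₁ (Rforest-Rtree-vanish (suc i) 0 (records-out-of-range (suc i) 0 (λ ()) (λ { (_ , () , _) })))
  nonempty-term≡0 : ∀ i → nonempty-term i ≡ 0
  nonempty-term≡0 i rewrite no-records i = *-zeroʳ (m C suc i)

Rtree-vanish : (n k : ℕ) → ¬ (1 ≤ n × 1 ≤ k × k ≤ n) → Rtree n k ≡ 0
Rtree-vanish zero    k _            = refl
Rtree-vanish (suc m) k not-in-range =
  proj₂ (Rforest-Rtree-vanish (suc m) k (records-out-of-range (suc m) k (λ ()) not-in-range))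

Rforest-recurrence : (n k : ℕ) → 1 ≤ n → 1 ≤ k → k ≤ n →
  Rforest n k ≡ sumFromTo (k ∸ 1) (n ∸ 1)
    (λ i → ((n ∸ 1) C i) * Rforest i (k ∸ 1) * (n ∸ i) ^ (n ∸ i ∸ 2) * (i + 1))
Rforest-recurrence (suc m) (suc k) _ _ (s≤s k≤m) =
  trans (forest-recurrence m k)
  (trans (∑Bools-cong m (λ s → cong (λ w → (Rforest (trues s) k * w) * #Forests (falses s)) (+-comm 1 (trues s))))
         (∑Bools-as-sumFromTo m k (λ i → Rforest i k) (_+ 1) (m≤n⇒m≤1+n k≤m)
           (λ i i<k → proj₁ (Rforest-Rtree-vanish i k (records-too-many i<k)))))

Rforest-vanish : (n k : ℕ) → ¬ (n ≡ 0 × k ≡ 0) → ¬ (1 ≤ n × 1 ≤ k × k ≤ n) → Rforest n k ≡ 0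
Rforest-vanish n k not-empty not-in-range =
  proj₁ (Rforest-Rtree-vanish n k (records-out-of-range n k not-empty not-in-range))

mainTheorem10 :
    ((n k : ℕ) → 1 ≤ n → 2 ≤ k → k ≤ n →
      Rtree n k ≡ sumFromTo (k ∸ 1) (n ∸ 1)
        (λ i → ((n ∸ 1) C i) * Rtree i (k ∸ 1) * (n ∸ i) ^ (n ∸ i ∸ 2) * i))
    × ((n : ℕ) → 1 ≤ n → Rtree n 1 ≡ n ^ (n ∸ 2))
    × ((n k : ℕ) → ¬ (1 ≤ n × 1 ≤ k × k ≤ n) → Rtree n k ≡ 0)
    × ((n k : ℕ) → 1 ≤ n → 1 ≤ k → k ≤ n →
      Rforest n k ≡ sumFromTo (k ∸ 1) (n ∸ 1)
        (λ i → ((n ∸ 1) C i) * Rforest i (k ∸ 1) * (n ∸ i) ^ (n ∸ i ∸ 2) * (i + 1)))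
    × Rforest 0 0 ≡ 1
    × ((n k : ℕ) → ¬ (n ≡ 0 × k ≡ 0) → ¬ (1 ≤ n × 1 ≤ k × k ≤ n) → Rforest n k ≡ 0)
mainTheorem10 = Rtree-recurrence , Rtree-one-record , Rtree-vanish , Rforest-recurrence , refl , Rforest-vanish
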